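{- Let $\mathcal{CO}$ be the class of cographs and $k\ge 0$ an integer. For all integers $i,j\geq k+2$, $$R_k^{\mathcal{CO}}(i,j)=1+\dfrac{(i-1)(j-1)-\{i-1\}\{j-1\}}{k+1},$$ where $\{x\}\in\{0,1,\dots,k\}$ denotes the residue of the integer $x$ modulo $k+1$.
   Context: All graphs are finite and simple. A cograph is a graph containing no induced path on four vertices (equivalently, a graph obtainable from single vertices by disjoint unions and complementation). For a graph $G$ and an integer $k\ge 0$, a $k$-sparse $j$-set is a set of exactly $j$ vertices of $G$ inducing a subgraph of maximum degree at most $k$; a $k$-dense $i$-set is a set of exactly $i$ vertices that is $k$-sparse in the complement of $G$. For a graph class $\mathcal{G}$, $R_k^{\mathcal{G}}(i,j)$ is the smallest natural number $n$ such that every graph on $n$ vertices in $\mathcal{G}$ has a $k$-dense $i$-set or a $k$-sparse $j$-set. -}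

module Defs where

open import Data.Nat using (ℕ; suc; _≤_; _<_)
open import Data.Bool using (Bool; true; false; not)
open import Data.Fin using (Fin)
open import Data.Fin.Subset using (Subset; _∈_; _∩_; ∣_∣)
open import Data.Vec using (tabulate)
open import Data.Product using (Σ; ∃; _×_)
open import Data.Sum using (_⊎_)
open import Relation.Binary.PropositionalEquality using (_≡_; _≢_)
open import Relation.Nullary using (¬_)

record Graph (n : ℕ) : Set where
  field
    adj   : Fin n → Fin n → Bool
    sym   : ∀ u v → adj u v ≡ adj v u
    irref : ∀ v → adj v v ≡ false
open Graph public

complement : ∀ {n} → Graph n → Graph n
complement G = record
  { adj   = λ u v → adj′ u v
  ; sym   = λ u v → symc u v
  ; irref = λ v → irc v }
  where
  open import Data.Fin.Properties using (_≟_)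
  open import Relation.Nullary using (yes; no)
  open import Relation.Binary.PropositionalEquality using (refl; cong)
  adj′ : _ → _ → Bool
  adj′ u v with u ≟ v
  ... | yes _ = false
  ... | no _  = not (Graph.adj G u v)
  symc : ∀ u v → adj′ u v ≡ adj′ v u
  symc u v with u ≟ v | v ≟ u
  ... | yes _ | yes _ = refl
  ... | yes p | no q = Data.Empty.⊥-elim (q (Relation.Binary.PropositionalEquality.sym p))
    where import Data.Empty
  ... | no p | yes q = Data.Empty.⊥-elim (p (Relation.Binary.PropositionalEquality.sym q))
    where import Data.Empty
  ... | no _ | no _ = cong not (Graph.sym G u v)
  irc : ∀ v → adj′ v v ≡ false
  irc v with v ≟ v
  ... | yes _ = refl
  ... | no p = Data.Empty.⊥-elim (p refl)
    where import Data.Empty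

nbhd : ∀ {n} → Graph n → Fin n → Subset n
nbhd G v = tabulate (adj G v)

InducedP4 : ∀ {n} → Graph n → Set
InducedP4 {n} G = Σ (Fin n) λ a → Σ (Fin n) λ b → Σ (Fin n) λ c → Σ (Fin n) λ d →
  (a ≢ b) × (a ≢ c) × (a ≢ d) × (b ≢ c) × (b ≢ d) × (c ≢ d) ×
  (adj G a b ≡ true) × (adj G b c ≡ true) × (adj G c d ≡ true) ×
  (adj G a c ≡ false) × (adj G b d ≡ false) × (adj G a d ≡ false)

IsCograph : ∀ {n} → Graph n → Set
IsCograph G = ¬ InducedP4 G

MaxDegInducedLE : ∀ {n} → Graph n → ℕ → Subset n → Set
MaxDegInducedLE G k S = ∀ v → v ∈ S → ∣ S ∩ nbhd G v ∣ ≤ k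

IsSparseSet : ∀ {n} → Graph n → ℕ → ℕ → Subset n → Set
IsSparseSet G k j S = (∣ S ∣ ≡ j) × MaxDegInducedLE G k S

IsDenseSet : ∀ {n} → Graph n → ℕ → ℕ → Subset n → Set
IsDenseSet G k i S = IsSparseSet (complement G) k i S

CoRamseyProp : ℕ → ℕ → ℕ → ℕ → Set
CoRamseyProp k i j n = (G : Graph n) → IsCograph G →
  (∃ λ S → IsDenseSet G k i S) ⊎ (∃ λ S → IsSparseSet G k j S)

IsCoRamseyNumber : ℕ → ℕ → ℕ → ℕ → Set
IsCoRamseyNumber k i j N = CoRamseyProp k i j N × (∀ m → m < N → ¬ CoRamseyProp k i j m)

-- Write r = k + 1 and F(x, y) = x ⌊y/r⌋ + ⌊x/r⌋ (y mod r), so that the claimed value is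
-- F(i − 1, j − 1) + 1.
--
-- In a cograph every set U of at least two vertices splits into two nonempty parts
-- that are either anticomplete or complete to each other. By induction on U, every U with ∣U∣ > k
-- contains a k-sparse set A and a k-dense set B, both larger than k, with ∣U∣ ≤ F(∣B∣, ∣A∣): across
-- an anticomplete split the sparse sets of the two parts unite while the larger dense set is kept,
-- and F is monotone and superadditive in its second argument; complete splits are anticomplete
-- splits of the complement, where the roles of A and B swap.
--
-- Let x = p + (a′ + 1) r and y = q + (b′ + 1) r with p, q < r. The cograph
--   ((K_{r+p} ⊔ K̄_q) ⋈ (K_r ⊔ K̄_q) ⋈ ⋯ ⋈ (K_r ⊔ K̄_q)) ⊔ (K̄_r ⋈ K_{p+a′r}) ⊔ ⋯ ⊔ (K̄_r ⋈ K_{p+a′r}),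
-- with a′ joined and b′ united blocks, has exactly F(x, y) vertices, no k-sparse set of more than y
-- and no k-dense set of more than x vertices. Its induced subgraphs cover all smaller orders.

module Submission where

open import Defs hiding (sym)
open import Function using (_∘_)
open import Data.Nat hiding (∣_-_∣)
open import Data.Nat.Properties
open import Data.Nat.DivMod
open import Data.Nat.Solver using (module +-*-Solver)
open +-*-Solver using (solve; _:+_; _:*_; _:=_; con)
open import Data.Bool using (Bool; true; false; not)
import Data.Bool.Properties as Bool
open import Data.Fin using (Fin; zero; suc; _↑ˡ_; _↑ʳ_; splitAt)
open import Data.Fin.Properties using (any?; ↑ˡ-injective; ↑ʳ-injective; splitAt-↑ˡ; splitAt-↑ʳ)
  renaming (_≟_ to _≟ᶠ_)
open import Data.Fin.Subset
open import Data.Fin.Subset.Properties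
open import Data.Vec using ([]; _∷_; _++_; replicate; tabulate; here; there)
import Data.Vec as Vec
open import Data.Vec.Properties using (zipWith-++; tabulate-cong; lookup∘tabulate; lookup⇒[]=; []=⇒lookup)
open import Data.Product using (∃; _×_; _,_; proj₂)
open import Data.Sum using (_⊎_; inj₁; inj₂)
import Data.Sum
open import Data.Empty using (⊥-elim) renaming (⊥ to ∅)
open import Relation.Nullary using (¬_; yes; no; Dec)
open import Relation.Nullary.Decidable using (_×-dec_)
open import Relation.Binary.PropositionalEquality

private variable
  a b n : ℕ

extremalOrder : ℕ → ℕ → ℕ → ℕ
extremalOrder k x y = x * (y / suc k) + (x / suc k) * (y % suc k)

module _ (k x y : ℕ) where
  private
    r = suc k
    p = x % r
    q = y % r
    x/r = x / r
    y/r = y / r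

  extremalOrder-divMod : r * extremalOrder k x y + p * q ≡ x * y
  extremalOrder-divMod = begin
    r * (x * y/r + x/r * q) + p * q              ≡⟨ cong (λ t → r * (t * y/r + x/r * q) + p * q) (m≡m%n+[m/n]*n x r) ⟩
    r * ((p + x/r * r) * y/r + x/r * q) + p * q  ≡⟨ solve 5 (λ r p a b q → r :* ((p :+ a :* r) :* b :+ a :* q) :+ p :* q
                                                                   := (p :+ a :* r) :* (q :+ b :* r)) refl r p x/r y/r q ⟩
    (p + x/r * r) * (q + y/r * r)                ≡⟨ cong₂ _*_ (m≡m%n+[m/n]*n x r) (m≡m%n+[m/n]*n y r) ⟨
    x * y                                        ∎
    where open ≡-Reasoning

  extremalOrder-comm : extremalOrder k x y ≡ extremalOrder k y x
  extremalOrder-comm = begin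
    x * y/r + x/r * q                ≡⟨ cong (λ t → t * y/r + x/r * q) (m≡m%n+[m/n]*n x r) ⟩
    (p + x/r * r) * y/r + x/r * q    ≡⟨ solve 5 (λ r p a b q → (p :+ a :* r) :* b :+ a :* q
                                                         := (q :+ b :* r) :* a :+ b :* p) refl r p x/r y/r q ⟩
    (q + y/r * r) * x/r + y/r * p    ≡⟨ cong (λ t → t * x/r + y/r * p) (m≡m%n+[m/n]*n y r) ⟨
    y * x/r + y/r * p                ∎
    where open ≡-Reasoning

  extremalOrder-formula : (x * y ∸ p * q) / r ≡ extremalOrder k x y
  extremalOrder-formula = begin
    (x * y ∸ p * q) / r                            ≡⟨ cong (λ t → (t ∸ p * q) / r) extremalOrder-divMod ⟨
    (r * extremalOrder k x y + p * q ∸ p * q) / r  ≡⟨ cong (_/ r) (m+n∸n≡m (r * extremalOrder k x y) (p * q)) ⟩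
    (r * extremalOrder k x y) / r                  ≡⟨ cong (_/ r) (*-comm r (extremalOrder k x y)) ⟩
    (extremalOrder k x y * r) / r                  ≡⟨ m*n/n≡m _ r ⟩
    extremalOrder k x y                            ∎
    where open ≡-Reasoning

  ≤-extremalOrder : suc k ≤ x → y ≤ extremalOrder k x y
  ≤-extremalOrder r≤x = begin
    y                  ≡⟨ m≡m%n+[m/n]*n y r ⟩
    q + y/r * r        ≡⟨ +-comm q _ ⟩
    y/r * r + q        ≤⟨ +-mono-≤ (≤-reflexive (*-comm y/r r)) (m≤n*m q x/r {{>-nonZero (m≥n⇒m/n>0 r≤x)}}) ⟩
    r * y/r + x/r * q  ≤⟨ +-monoˡ-≤ (x/r * q) (*-monoˡ-≤ y/r r≤x) ⟩
    x * y/r + x/r * q  ∎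
    where open ≤-Reasoning

extremalOrder-monoˡ-≤ : ∀ k {x x′} y → x ≤ x′ → extremalOrder k x y ≤ extremalOrder k x′ y
extremalOrder-monoˡ-≤ k y x≤x′ =
  +-mono-≤ (*-monoˡ-≤ (y / suc k) x≤x′) (*-monoˡ-≤ (y % suc k) (/-monoˡ-≤ (suc k) x≤x′))

extremalOrder-mono-≤ : ∀ k {x x′ y y′} → x ≤ x′ → y ≤ y′ → extremalOrder k x y ≤ extremalOrder k x′ y′
extremalOrder-mono-≤ k {x} {x′} {y} {y′} x≤x′ y≤y′ = begin
  extremalOrder k x y      ≤⟨ extremalOrder-monoˡ-≤ k y x≤x′ ⟩
  extremalOrder k x′ y     ≡⟨ extremalOrder-comm k x′ y ⟩
  extremalOrder k y x′     ≤⟨ extremalOrder-monoˡ-≤ k x′ y≤y′ ⟩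
  extremalOrder k y′ x′    ≡⟨ extremalOrder-comm k y′ x′ ⟩
  extremalOrder k x′ y′    ∎
  where open ≤-Reasoning

-- Multiplied by r and shifted by p (q + q′), both sides become x (y + y′) by extremalOrder-divMod,
-- up to (y + y′) % r ≤ q + q′.
extremalOrder-superadditiveʳ : ∀ k x y y′ →
  extremalOrder k x y + extremalOrder k x y′ ≤ extremalOrder k x (y + y′)
extremalOrder-superadditiveʳ k x y y′ = *-cancelˡ-≤ r (+-cancelʳ-≤ (p * (q + q′)) _ _ (begin
  r * (F y + F y′) + p * (q + q′)
    ≡⟨ solve 6 (λ r f f′ p q q′ → r :* (f :+ f′) :+ p :* (q :+ q′)
                                  := (r :* f :+ p :* q) :+ (r :* f′ :+ p :* q′)) refl r (F y) (F y′) p q q′ ⟩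
  (r * F y + p * q) + (r * F y′ + p * q′)
    ≡⟨ cong₂ _+_ (extremalOrder-divMod k x y) (extremalOrder-divMod k x y′) ⟩
  x * y + x * y′
    ≡⟨ *-distribˡ-+ x y y′ ⟨
  x * (y + y′)
    ≡⟨ extremalOrder-divMod k x (y + y′) ⟨
  r * F (y + y′) + p * ((y + y′) % r)
    ≤⟨ +-monoʳ-≤ (r * F (y + y′)) (*-monoʳ-≤ p %-subadditive) ⟩
  r * F (y + y′) + p * (q + q′)
    ∎))
  where
  open ≤-Reasoning
  r = suc k
  F = extremalOrder k x
  p = x % r
  q = y % r
  q′ = y′ % r
  %-subadditive : (y + y′) % r ≤ q + q′
  %-subadditive = subst (_≤ q + q′) (sym (%-distribˡ-+ y y′ r)) (m%n≤m (q + q′) r)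

Disjoint : Subset n → Subset n → Set
Disjoint p q = ∀ {x} → x ∈ p → x ∉ q

x∈p─q⇒x∉q : ∀ (p q : Subset n) {x} → x ∈ p ─ q → x ∉ q
x∈p─q⇒x∉q (_ ∷ p) (outside ∷ q) here      ()
x∈p─q⇒x∉q (_ ∷ p) (_ ∷ q)       (there m) (there m′) = x∈p─q⇒x∉q p q m m′

q∩p─q≡∅ : ∀ (p q : Subset n) → Disjoint q (p ─ q)
q∩p─q≡∅ p q x∈q x∈p─q = x∈p─q⇒x∉q p q x∈p─q x∈q

x∈p⇒x∈q⊎x∈p─q : ∀ {p : Subset n} q {x} → x ∈ p → x ∈ q ⊎ x ∈ p ─ q
x∈p⇒x∈q⊎x∈p─q q {x} x∈p with x ∈? q
... | yes x∈q = inj₁ x∈q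
... | no x∉q  = inj₂ (x∈p∧x∉q⇒x∈p─q x∈p x∉q)

∣p∣≡∣q∣+∣p─q∣ : ∀ (p q : Subset n) → q ⊆ p → ∣ p ∣ ≡ ∣ q ∣ + ∣ p ─ q ∣
∣p∣≡∣q∣+∣p─q∣ []            []            _   = refl
∣p∣≡∣q∣+∣p─q∣ (inside ∷ p)  (inside ∷ q)  q⊆p = cong suc (∣p∣≡∣q∣+∣p─q∣ p q (drop-∷-⊆ q⊆p))
∣p∣≡∣q∣+∣p─q∣ (inside ∷ p)  (outside ∷ q) q⊆p =
  trans (cong suc (∣p∣≡∣q∣+∣p─q∣ p q (drop-∷-⊆ q⊆p))) (sym (+-suc ∣ q ∣ _))
∣p∣≡∣q∣+∣p─q∣ (outside ∷ p) (outside ∷ q) q⊆p = ∣p∣≡∣q∣+∣p─q∣ p q (drop-∷-⊆ q⊆p)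
∣p∣≡∣q∣+∣p─q∣ (outside ∷ p) (inside ∷ q)  q⊆p with q⊆p here
... | ()

∣p∪q∣+∣p∩q∣≡∣p∣+∣q∣ : ∀ (p q : Subset n) → ∣ p ∪ q ∣ + ∣ p ∩ q ∣ ≡ ∣ p ∣ + ∣ q ∣
∣p∪q∣+∣p∩q∣≡∣p∣+∣q∣ []          []          = refl
∣p∪q∣+∣p∩q∣≡∣p∣+∣q∣ (false ∷ p) (false ∷ q) = ∣p∪q∣+∣p∩q∣≡∣p∣+∣q∣ p q
∣p∪q∣+∣p∩q∣≡∣p∣+∣q∣ (false ∷ p) (true ∷ q)  =
  trans (cong suc (∣p∪q∣+∣p∩q∣≡∣p∣+∣q∣ p q)) (sym (+-suc ∣ p ∣ ∣ q ∣))
∣p∪q∣+∣p∩q∣≡∣p∣+∣q∣ (true ∷ p)  (false ∷ q) = cong suc (∣p∪q∣+∣p∩q∣≡∣p∣+∣q∣ p q)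
∣p∪q∣+∣p∩q∣≡∣p∣+∣q∣ (true ∷ p)  (true ∷ q)  = cong suc (begin
  ∣ p ∪ q ∣ + suc ∣ p ∩ q ∣    ≡⟨ +-suc ∣ p ∪ q ∣ ∣ p ∩ q ∣ ⟩
  suc (∣ p ∪ q ∣ + ∣ p ∩ q ∣)  ≡⟨ cong suc (∣p∪q∣+∣p∩q∣≡∣p∣+∣q∣ p q) ⟩
  suc (∣ p ∣ + ∣ q ∣)          ≡⟨ +-suc ∣ p ∣ ∣ q ∣ ⟨
  ∣ p ∣ + suc ∣ q ∣            ∎)
  where open ≡-Reasoning

∣p∪q∣≤∣p∣+∣q∣ : ∀ (p q : Subset n) → ∣ p ∪ q ∣ ≤ ∣ p ∣ + ∣ q ∣
∣p∪q∣≤∣p∣+∣q∣ p q = subst (∣ p ∪ q ∣ ≤_) (∣p∪q∣+∣p∩q∣≡∣p∣+∣q∣ p q) (m≤m+n _ _)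

∣empty∣ : ∀ {p : Subset n} → ¬ Nonempty p → ∣ p ∣ ≡ 0
∣empty∣ {n} e = trans (cong ∣_∣ (Empty-unique e)) (∣⊥∣≡0 n)

∣p∪q∣≡∣p∣+∣q∣ : ∀ (p q : Subset n) → Disjoint p q → ∣ p ∪ q ∣ ≡ ∣ p ∣ + ∣ q ∣
∣p∪q∣≡∣p∣+∣q∣ p q disjoint = begin
  ∣ p ∪ q ∣                  ≡⟨ +-identityʳ _ ⟨
  ∣ p ∪ q ∣ + 0              ≡⟨ cong (∣ p ∪ q ∣ +_) (∣empty∣ p∩q=∅) ⟨
  ∣ p ∪ q ∣ + ∣ p ∩ q ∣      ≡⟨ ∣p∪q∣+∣p∩q∣≡∣p∣+∣q∣ p q ⟩
  ∣ p ∣ + ∣ q ∣              ∎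
  where
  open ≡-Reasoning
  p∩q=∅ : ¬ Nonempty (p ∩ q)
  p∩q=∅ (x , x∈p∩q) = let x∈p , x∈q = x∈p∩q⁻ p q x∈p∩q in disjoint x∈p x∈q

∣p∣>0⇒nonempty : ∀ (p : Subset n) → 0 < ∣ p ∣ → Nonempty p
∣p∣>0⇒nonempty p 0<∣p∣ with nonempty? p
... | yes ne = ne
... | no ¬ne = ⊥-elim (<⇒≢ 0<∣p∣ (sym (∣empty∣ ¬ne)))

x∈p⇒⁅x⁆⊆p : ∀ {p : Subset n} {x} → x ∈ p → ⁅ x ⁆ ⊆ p
x∈p⇒⁅x⁆⊆p {p = p} {x} x∈p y∈⁅x⁆ = subst (_∈ p) (sym (x∈⁅y⁆⇒x≡y x y∈⁅x⁆)) x∈p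

nonempty⇒∣p∣>0 : ∀ {p : Subset n} → Nonempty p → 0 < ∣ p ∣
nonempty⇒∣p∣>0 (x , x∈p) = subst (_≤ _) (∣⁅x⁆∣≡1 x) (p⊆q⇒∣p∣≤∣q∣ (x∈p⇒⁅x⁆⊆p x∈p))

∣p∣≡1+∣p-x∣ : ∀ {p : Subset n} {x} → x ∈ p → ∣ p ∣ ≡ suc ∣ p - x ∣
∣p∣≡1+∣p-x∣ {p = p} {x} x∈p =
  trans (∣p∣≡∣q∣+∣p─q∣ p ⁅ x ⁆ (x∈p⇒⁅x⁆⊆p x∈p)) (cong (_+ ∣ p - x ∣) (∣⁅x⁆∣≡1 x))

two≤∣p∣ : ∀ {p : Subset n} {x y} → x ∈ p → y ∈ p → x ≢ y → 2 ≤ ∣ p ∣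
two≤∣p∣ {p = p} x∈p y∈p x≢y =
  subst (2 ≤_) (sym (∣p∣≡1+∣p-x∣ x∈p)) (s≤s (nonempty⇒∣p∣>0 (_ , x∈p∧x≢y⇒x∈p-y y∈p (x≢y ∘ sym))))

subset-of-size : ∀ j (p : Subset n) → j ≤ ∣ p ∣ → ∃ λ q → q ⊆ p × ∣ q ∣ ≡ j
subset-of-size {n} zero p _ = ⊥ , (λ x∈⊥ → ⊥-elim (∉⊥ x∈⊥)) , ∣⊥∣≡0 n
subset-of-size (suc j) (inside ∷ p) (s≤s j≤∣p∣) with subset-of-size j p j≤∣p∣
... | q , q⊆p , ∣q∣≡j = inside ∷ q , (λ { here → here ; (there m) → there (q⊆p m) }) , cong suc ∣q∣≡j
subset-of-size (suc j) (outside ∷ p) j≤∣p∣ with subset-of-size (suc j) p j≤∣p∣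
... | q , q⊆p , ∣q∣≡j = outside ∷ q , (λ { (there m) → there (q⊆p m) }) , ∣q∣≡j

tabulate-++ : ∀ {A : Set} a {b} (f : Fin (a + b) → A) →
  tabulate f ≡ tabulate (f ∘ (_↑ˡ b)) ++ tabulate (f ∘ (a ↑ʳ_))
tabulate-++ zero    f = refl
tabulate-++ (suc a) f = cong (f zero ∷_) (tabulate-++ a (f ∘ suc))

tabulate-const : ∀ {A : Set} n (x : A) → tabulate {n = n} (λ _ → x) ≡ replicate n x
tabulate-const zero    x = refl
tabulate-const (suc n) x = cong (x ∷_) (tabulate-const n x)

∣p++q∣ : (p : Subset a) (q : Subset b) → ∣ p ++ q ∣ ≡ ∣ p ∣ + ∣ q ∣
∣p++q∣ []          q = refl
∣p++q∣ (true ∷ p)  q = cong suc (∣p++q∣ p q)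
∣p++q∣ (false ∷ p) q = ∣p++q∣ p q

∩-++ : (p p′ : Subset a) (q q′ : Subset b) → (p ++ q) ∩ (p′ ++ q′) ≡ (p ∩ p′) ++ (q ∩ q′)
∩-++ p p′ q q′ = zipWith-++ _ p q p′ q′

∈-++⁺ˡ : ∀ {p : Subset a} (q : Subset b) {x} → x ∈ p → x ↑ˡ b ∈ p ++ q
∈-++⁺ˡ q here      = here
∈-++⁺ˡ q (there m) = there (∈-++⁺ˡ q m)

∈-++⁺ʳ : ∀ (p : Subset a) {q : Subset b} {y} → y ∈ q → a ↑ʳ y ∈ p ++ q
∈-++⁺ʳ []      m = m
∈-++⁺ʳ (s ∷ p) m = there (∈-++⁺ʳ p m)

∈-++⁻ˡ : ∀ (p : Subset a) {q : Subset b} {x} → x ↑ˡ b ∈ p ++ q → x ∈ p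
∈-++⁻ˡ (s ∷ p) {x = zero}  here      = here
∈-++⁻ˡ (s ∷ p) {x = suc x} (there m) = there (∈-++⁻ˡ p m)

∈-++⁻ʳ : ∀ (p : Subset a) {q : Subset b} {y} → a ↑ʳ y ∈ p ++ q → y ∈ q
∈-++⁻ʳ []      m         = m
∈-++⁻ʳ (s ∷ p) (there m) = ∈-++⁻ʳ p m

nonempty-++⁻ : ∀ (p : Subset a) {q : Subset b} → Nonempty (p ++ q) → Nonempty p ⊎ Nonempty q
nonempty-++⁻ []      ne                = inj₂ ne
nonempty-++⁻ (s ∷ p) (zero  , here)    = inj₁ (zero , here)
nonempty-++⁻ (s ∷ p) (suc u , there m) with nonempty-++⁻ p (u , m)
... | inj₁ (x , m′) = inj₁ (suc x , there m′)
... | inj₂ ne       = inj₂ ne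

subset-++-elim : ∀ {P : Subset (a + b) → Set} → (∀ (p : Subset a) (q : Subset b) → P (p ++ q)) → ∀ S → P S
subset-++-elim {a} f S with Vec.splitAt a S
... | p , q , refl = f p q

∣p++⊥∣ : ∀ (p : Subset a) → ∣ p ++ ⊥ {n = b} ∣ ≡ ∣ p ∣
∣p++⊥∣ {b = b} p = trans (∣p++q∣ p ⊥) (trans (cong (∣ p ∣ +_) (∣⊥∣≡0 b)) (+-identityʳ _))

∣p∩replicate-false∣ : ∀ (p : Subset n) → ∣ p ∩ replicate n false ∣ ≡ 0
∣p∩replicate-false∣ {n} p = trans (cong ∣_∣ (∩-zeroʳ p)) (∣⊥∣≡0 n)

∣p∩replicate-true∣ : ∀ (p : Subset n) → ∣ p ∩ replicate n true ∣ ≡ ∣ p ∣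
∣p∩replicate-true∣ p = cong ∣_∣ (∩-identityʳ p)

true≢false : ∀ {b : Bool} → b ≡ true → b ≡ false → ∅
true≢false refl ()

complement-adj : ∀ (G : Graph n) {u v} → u ≢ v → adj (complement G) u v ≡ not (adj G u v)
complement-adj G {u} {v} u≢v with u ≟ᶠ v
... | yes u≡v = ⊥-elim (u≢v u≡v)
... | no _    = refl

module _ (G : Graph n) {u v : Fin n} (u≢v : u ≢ v) where

  complement-edge : adj (complement G) u v ≡ true → adj G u v ≡ false
  complement-edge e = Bool.not-injective (trans (sym (complement-adj G u≢v)) e)

  complement-non-edge : adj (complement G) u v ≡ false → adj G u v ≡ true
  complement-non-edge e = Bool.not-injective (trans (sym (complement-adj G u≢v)) e)

∈-nbhd⁺ : ∀ (G : Graph n) {v w} → adj G v w ≡ true → w ∈ nbhd G v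
∈-nbhd⁺ G {v} {w} e = lookup⇒[]= w (nbhd G v) (trans (lookup∘tabulate (adj G v) w) e)

∈-nbhd⁻ : ∀ (G : Graph n) {v w} → w ∈ nbhd G v → adj G v w ≡ true
∈-nbhd⁻ G {v} {w} m = trans (sym (lookup∘tabulate (adj G v) w)) ([]=⇒lookup m)

Anticomplete Complete : Graph n → Subset n → Subset n → Set
Anticomplete G X Y = ∀ {u v} → u ∈ X → v ∈ Y → adj G u v ≡ false
Complete     G X Y = ∀ {u v} → u ∈ X → v ∈ Y → adj G u v ≡ true

module _ (G : Graph n) {X Y : Subset n} where

  anticomplete-sym : Anticomplete G X Y → Anticomplete G Y X
  anticomplete-sym anti u∈Y v∈X = trans (Graph.sym G _ _) (anti v∈X u∈Y)

  private
    distinct : Disjoint X Y → ∀ {u v} → u ∈ X → v ∈ Y → u ≢ v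
    distinct disjoint u∈X v∈Y refl = disjoint u∈X v∈Y

  complete⇒anticomplete-complement : Disjoint X Y → Complete G X Y → Anticomplete (complement G) X Y
  complete⇒anticomplete-complement disjoint comp u∈X v∈Y =
    trans (complement-adj G (distinct disjoint u∈X v∈Y)) (cong not (comp u∈X v∈Y))

  anticomplete-complement⇒complete : Disjoint X Y → Anticomplete (complement G) X Y → Complete G X Y
  anticomplete-complement⇒complete disjoint anti u∈X v∈Y =
    complement-non-edge G (distinct disjoint u∈X v∈Y) (anti u∈X v∈Y)

  complete-complement⇒anticomplete : Disjoint X Y → Complete (complement G) X Y → Anticomplete G X Y
  complete-complement⇒anticomplete disjoint comp u∈X v∈Y =
    complement-edge G (distinct disjoint u∈X v∈Y) (comp u∈X v∈Y)

module _ (G : Graph n) (k : ℕ) where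

  MaxDegInducedLE-⊆ : ∀ {S T} → T ⊆ S → MaxDegInducedLE G k S → MaxDegInducedLE G k T
  MaxDegInducedLE-⊆ {S} {T} T⊆S md v v∈T = ≤-trans (p⊆q⇒∣p∣≤∣q∣ T∩N⊆S∩N) (md v (T⊆S v∈T))
    where
    T∩N⊆S∩N : T ∩ nbhd G v ⊆ S ∩ nbhd G v
    T∩N⊆S∩N m = let x∈T , x∈N = x∈p∩q⁻ T (nbhd G v) m in x∈p∩q⁺ (T⊆S x∈T , x∈N)

  MaxDegInducedLE-small : ∀ S → ∣ S ∣ ≤ suc k → MaxDegInducedLE G k S
  MaxDegInducedLE-small S ∣S∣≤1+k v v∈S = ≤-pred (≤-trans (p⊂q⇒∣p∣<∣q∣ S∩N⊂S) ∣S∣≤1+k)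
    where
    v∉N : v ∉ nbhd G v
    v∉N v∈N = true≢false (∈-nbhd⁻ G v∈N) (irref G v)
    S∩N⊂S : S ∩ nbhd G v ⊂ S
    S∩N⊂S = p∩q⊆p S (nbhd G v) , v , v∈S , v∉N ∘ proj₂ ∘ x∈p∩q⁻ S (nbhd G v)

  neighbours-∪ : ∀ {B₁ B₂ v} → v ∈ B₁ → Anticomplete G B₁ B₂ → (B₁ ∪ B₂) ∩ nbhd G v ⊆ B₁ ∩ nbhd G v
  neighbours-∪ {B₁} {B₂} {v} v∈B₁ anti m with x∈p∩q⁻ (B₁ ∪ B₂) (nbhd G v) m
  ... | x∈B , x∈N with x∈p∪q⁻ B₁ B₂ x∈B
  ...   | inj₁ x∈B₁ = x∈p∩q⁺ (x∈B₁ , x∈N)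
  ...   | inj₂ x∈B₂ = ⊥-elim (true≢false (∈-nbhd⁻ G x∈N) (anti v∈B₁ x∈B₂))

  MaxDegInducedLE-∪ : ∀ {A₁ A₂} → Anticomplete G A₁ A₂ →
    MaxDegInducedLE G k A₁ → MaxDegInducedLE G k A₂ → MaxDegInducedLE G k (A₁ ∪ A₂)
  MaxDegInducedLE-∪ {A₁} {A₂} anti md₁ md₂ v v∈A with x∈p∪q⁻ A₁ A₂ v∈A
  ... | inj₁ v∈A₁ = ≤-trans (p⊆q⇒∣p∣≤∣q∣ (neighbours-∪ v∈A₁ anti)) (md₁ v v∈A₁)
  ... | inj₂ v∈A₂ rewrite ∪-comm A₁ A₂ =
    ≤-trans (p⊆q⇒∣p∣≤∣q∣ (neighbours-∪ v∈A₂ (anticomplete-sym G anti))) (md₂ v v∈A₂)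

-- P4 is self-complementary: the complement of the path a b c d is the path c a d b.
isCograph-complement : ∀ {G : Graph n} → IsCograph G → IsCograph (complement G)
isCograph-complement {G = G} cograph
  (a , b , c , d , a≢b , a≢c , a≢d , b≢c , b≢d , c≢d , ab , bc , cd , ac , bd , ad) =
  cograph (c , a , d , b , a≢c ∘ sym , c≢d , b≢c ∘ sym , a≢d , a≢b , b≢d ∘ sym ,
    trans (Graph.sym G c a) (complement-non-edge G a≢c ac) , complement-non-edge G a≢d ad ,
    trans (Graph.sym G d b) (complement-non-edge G b≢d bd) ,
    complement-edge G c≢d cd , complement-edge G a≢b ab , trans (Graph.sym G c b) (complement-edge G b≢c bc))

-- Splitting cographs

record Split (G : Graph n) (U : Subset n) : Set where
  field
    part          : Subset n
    part⊆U        : part ⊆ U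
    part-nonempty : Nonempty part
    rest-nonempty : Nonempty (U ─ part)
    homogeneous   : Anticomplete G part (U ─ part) ⊎ Complete G part (U ─ part)

split-complement : ∀ {G : Graph n} {U} → Split (complement G) U → Split G U
split-complement {G = G} {U} s = record
  { part = part ; part⊆U = part⊆U ; part-nonempty = part-nonempty ; rest-nonempty = rest-nonempty
  ; homogeneous = flip homogeneous }
  where
  open Split s
  disjoint = q∩p─q≡∅ U part
  flip : Anticomplete (complement G) part (U ─ part) ⊎ Complete (complement G) part (U ─ part) →
         Anticomplete G part (U ─ part) ⊎ Complete G part (U ─ part)
  flip (inj₁ anti) = inj₂ (anticomplete-complement⇒complete G disjoint anti)
  flip (inj₂ comp) = inj₁ (complete-complement⇒anticomplete G disjoint comp)

module SplitStep (G : Graph n) (G-cograph : IsCograph G) {U : Subset n} {v : Fin n} (v∈U : v ∈ U) where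

  W : Subset n
  W = U - v

  W⊆U : W ⊆ U
  W⊆U = p─q⊆p U ⁅ v ⁆

  v∉W : v ∉ W
  v∉W v∈W = x∈p─q⇒x∉q U ⁅ v ⁆ v∈W (x∈⁅x⁆ v)

  split-off-v : Nonempty W →
    (∀ {z} → z ∈ W → adj G v z ≡ false) ⊎ (∀ {z} → z ∈ W → adj G v z ≡ true) → Split G U
  split-off-v W≠∅ homogeneous = record
    { part = ⁅ v ⁆ ; part⊆U = x∈p⇒⁅x⁆⊆p v∈U ; part-nonempty = v , x∈⁅x⁆ v ; rest-nonempty = W≠∅
    ; homogeneous = Data.Sum.map from-v from-v homogeneous }
    where
    from-v : ∀ {b} → (∀ {z} → z ∈ W → adj G v z ≡ b) → ∀ {u z} → u ∈ ⁅ v ⁆ → z ∈ W → adj G u z ≡ b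
    from-v v-to-W u∈⁅v⁆ z∈W rewrite x∈⁅y⁆⇒x≡y v u∈⁅v⁆ = v-to-W z∈W

  module Extend {W₁ W₂ : Subset n} (cover : ∀ {u} → u ∈ W → u ∈ W₁ ⊎ u ∈ W₂) (W₁⊆W : W₁ ⊆ W) (W₂⊆W : W₂ ⊆ W)
                (disjoint : Disjoint W₁ W₂) (anti : Anticomplete G W₁ W₂) where

    split-off-W₂ : Nonempty W₂ → (∀ {x} → x ∈ W₂ → adj G v x ≡ false) → Split G U
    split-off-W₂ W₂≠∅ no-neighbour = record
      { part = W₂ ; part⊆U = W⊆U ∘ W₂⊆W ; part-nonempty = W₂≠∅
      ; rest-nonempty = v , x∈p∧x∉q⇒x∈p─q v∈U (v∉W ∘ W₂⊆W)
      ; homogeneous = inj₁ isolated }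
      where
      isolated : Anticomplete G W₂ (U ─ W₂)
      isolated {u} {z} u∈W₂ z∈rest with z ≟ᶠ v
      ... | yes refl = trans (Graph.sym G u v) (no-neighbour u∈W₂)
      ... | no z≢v with cover (x∈p∧x≢y⇒x∈p-y (p─q⊆p U W₂ z∈rest) z≢v)
      ...   | inj₁ z∈W₁ = anticomplete-sym G anti u∈W₂ z∈W₁
      ...   | inj₂ z∈W₂ = ⊥-elim (x∈p─q⇒x∉q U W₂ z∈rest z∈W₂)

    -- An edge from a non-neighbour u ∈ W₁ of v to a neighbour z ∈ W₁ of v would give the induced
    -- path u z v x, for any neighbour x ∈ W₂ of v.
    split-off-non-neighbours : ∀ {w x} → w ∈ W₁ → adj G v w ≡ false → x ∈ W₂ → adj G v x ≡ true → Split G U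
    split-off-non-neighbours {w} {x} w∈W₁ vw x∈W₂ vx = record
      { part = X ; part⊆U = W⊆U ∘ W₁⊆W ∘ p─q⊆p W₁ (nbhd G v)
      ; part-nonempty = w , x∈p∧x∉q⇒x∈p─q w∈W₁ (λ w∈N → true≢false (∈-nbhd⁻ G w∈N) vw)
      ; rest-nonempty = v , x∈p∧x∉q⇒x∈p─q v∈U (v∉W ∘ W₁⊆W ∘ p─q⊆p W₁ (nbhd G v))
      ; homogeneous = inj₁ isolated }
      where
      X = W₁ ─ nbhd G v
      isolated : Anticomplete G X (U ─ X)
      isolated {u} {z} u∈X z∈rest = Bool.¬-not no-edge
        where
        u∈W₁ = p─q⊆p W₁ (nbhd G v) u∈X
        u∉N = x∈p─q⇒x∉q W₁ (nbhd G v) u∈X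
        uv : adj G u v ≡ false
        uv = Bool.¬-not λ e → u∉N (∈-nbhd⁺ G (trans (Graph.sym G v u) e))
        no-edge : adj G u z ≢ true
        no-edge uz with z ≟ᶠ v
        ... | yes refl = true≢false uz uv
        ... | no z≢v with cover (x∈p∧x≢y⇒x∈p-y (p─q⊆p U X z∈rest) z≢v)
        ...   | inj₂ z∈W₂ = true≢false uz (anti u∈W₁ z∈W₂)
        ...   | inj₁ z∈W₁ with z ∈? nbhd G v
        ...     | no z∉N = x∈p─q⇒x∉q U X z∈rest (x∈p∧x∉q⇒x∈p─q z∈W₁ z∉N)
        ...     | yes z∈N = G-cograph (u , z , v , x ,
                    (λ { refl → u∉N z∈N }) , (λ { refl → v∉W (W₁⊆W u∈W₁) }) ,
                    (λ { refl → disjoint u∈W₁ x∈W₂ }) , z≢v , (λ { refl → disjoint z∈W₁ x∈W₂ }) ,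
                    (λ { refl → v∉W (W₂⊆W x∈W₂) }) ,
                    uz , trans (Graph.sym G z v) (∈-nbhd⁻ G z∈N) , vx ,
                    uv , anti z∈W₁ x∈W₂ , anti u∈W₁ x∈W₂)

  extend : ∀ {W₁ W₂} → (∀ {u} → u ∈ W → u ∈ W₁ ⊎ u ∈ W₂) → W₁ ⊆ W → W₂ ⊆ W → Disjoint W₁ W₂ →
    Anticomplete G W₁ W₂ → Nonempty W₂ → ∀ {w} → w ∈ W₁ → adj G v w ≡ false → Split G U
  extend {W₂ = W₂} cover W₁⊆W W₂⊆W disjoint anti W₂≠∅ w∈W₁ vw
    with any? (λ x → (x ∈? W₂) ×-dec (adj G v x Bool.≟ true))
  ... | no no-neighbour       = split-off-W₂ W₂≠∅ λ x∈W₂ → Bool.¬-not λ vx → no-neighbour (_ , x∈W₂ , vx)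
    where open Extend cover W₁⊆W W₂⊆W disjoint anti
  ... | yes (x , x∈W₂ , vx) = split-off-non-neighbours w∈W₁ vw x∈W₂ vx
    where open Extend cover W₁⊆W W₂⊆W disjoint anti

  extend-split : ∀ {Y} → Y ⊆ W → Nonempty Y → Nonempty (W ─ Y) → Anticomplete G Y (W ─ Y) →
    ∀ {w} → w ∈ W → adj G v w ≡ false → Split G U
  extend-split {Y} Y⊆W Y≠∅ W─Y≠∅ anti {w} w∈W vw with w ∈? Y
  ... | yes w∈Y = extend (x∈p⇒x∈q⊎x∈p─q Y) Y⊆W (p─q⊆p W Y) (q∩p─q≡∅ W Y) anti W─Y≠∅ w∈Y vw
  ... | no w∉Y  = extend (Data.Sum.swap ∘ x∈p⇒x∈q⊎x∈p─q Y) (p─q⊆p W Y) Y⊆W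
                    (λ u∈W─Y u∈Y → q∩p─q≡∅ W Y u∈Y u∈W─Y) (anticomplete-sym G anti) Y≠∅
                    (x∈p∧x∉q⇒x∈p─q w∈W w∉Y) vw

-- Induction on ∣ U ∣: unless a vertex v is complete or anticomplete to U - v, split U - v and extend.
split : ∀ {G : Graph n} → IsCograph G → ∀ m (U : Subset n) → ∣ U ∣ ≤ m → 2 ≤ ∣ U ∣ → Split G U
split cograph zero U ∣U∣≤0 2≤∣U∣ = ⊥-elim (<⇒≱ (≤-trans (s≤s z≤n) 2≤∣U∣) ∣U∣≤0)
split {n} {G} cograph (suc m) U ∣U∣≤1+m 2≤∣U∣ with ∣p∣>0⇒nonempty U (≤-trans (s≤s z≤n) 2≤∣U∣)
... | v , v∈U = by-neighbours (any? (λ w → (w ∈? W) ×-dec (adj G v w Bool.≟ false)))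
                              (any? (λ x → (x ∈? W) ×-dec (adj G v x Bool.≟ true)))
  where
  open SplitStep G cograph v∈U

  ∣U∣≡1+∣W∣ : ∣ U ∣ ≡ suc ∣ W ∣
  ∣U∣≡1+∣W∣ = ∣p∣≡1+∣p-x∣ v∈U

  W≠∅ : Nonempty W
  W≠∅ = ∣p∣>0⇒nonempty W (≤-pred (subst (2 ≤_) ∣U∣≡1+∣W∣ 2≤∣U∣))

  by-neighbours : Dec (∃ λ w → w ∈ W × adj G v w ≡ false) → Dec (∃ λ x → x ∈ W × adj G v x ≡ true) →
    Split G U
  by-neighbours (no all-neighbours) _ =
    split-off-v W≠∅ (inj₂ λ z∈W → Bool.¬-not λ vz → all-neighbours (_ , z∈W , vz))
  by-neighbours _ (no no-neighbour) =
    split-off-v W≠∅ (inj₁ λ z∈W → Bool.¬-not λ vz → no-neighbour (_ , z∈W , vz))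
  by-neighbours (yes (w , w∈W , vw)) (yes (x , x∈W , vx))
    with split {G = G} cograph m W ∣W∣≤m (two≤∣p∣ w∈W x∈W w≢x)
    where
    w≢x : w ≢ x
    w≢x refl = true≢false vx vw
    ∣W∣≤m : ∣ W ∣ ≤ m
    ∣W∣≤m = ≤-pred (subst (_≤ suc m) ∣U∣≡1+∣W∣ ∣U∣≤1+m)
  ... | record { part = Y ; part⊆U = Y⊆W ; part-nonempty = Y≠∅ ; rest-nonempty = W─Y≠∅ ; homogeneous = hom } =
    by-side hom
    where
    by-side : Anticomplete G Y (W ─ Y) ⊎ Complete G Y (W ─ Y) → Split G U
    by-side (inj₁ anti) = extend-split Y⊆W Y≠∅ W─Y≠∅ anti w∈W vw
    by-side (inj₂ comp) = split-complement
      (SplitStep.extend-split (complement G) (isCograph-complement cograph) v∈U Y⊆W Y≠∅ W─Y≠∅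
        (complete⇒anticomplete-complement G (q∩p─q≡∅ W Y) comp) x∈W
        (trans (complement-adj G λ { refl → v∉W x∈W }) (cong not vx)))

-- Upper bound

-- The invariant of the upper bound. In use H′ is the complement of H; keeping the two graphs
-- independent makes complementation a mere swap of the two sets.
record Witness (k : ℕ) (H H′ : Graph n) (U : Subset n) : Set where
  field
    sparse dense : Subset n
    sparse⊆U     : sparse ⊆ U
    dense⊆U      : dense ⊆ U
    sparse-ok    : MaxDegInducedLE H k sparse
    dense-ok     : MaxDegInducedLE H′ k dense
    sparse-large : suc k ≤ ∣ sparse ∣
    dense-large  : suc k ≤ ∣ dense ∣
    bound        : ∣ U ∣ ≤ extremalOrder k ∣ dense ∣ ∣ sparse ∣

witness-swap : ∀ {k} {H H′ : Graph n} {U} → Witness k H H′ U → Witness k H′ H U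
witness-swap {k = k} {U = U} w = record
  { sparse = dense ; dense = sparse ; sparse⊆U = dense⊆U ; dense⊆U = sparse⊆U
  ; sparse-ok = dense-ok ; dense-ok = sparse-ok ; sparse-large = dense-large ; dense-large = sparse-large
  ; bound = subst (∣ U ∣ ≤_) (extremalOrder-comm k (∣ dense ∣) (∣ sparse ∣)) bound }
  where open Witness w

module Combine (k : ℕ) (H H′ : Graph n) {U U₁ U₂ : Subset n} (U₁⊆U : U₁ ⊆ U) (U₂⊆U : U₂ ⊆ U)
  (disjoint : Disjoint U₁ U₂) (∣U∣≡ : ∣ U ∣ ≡ ∣ U₁ ∣ + ∣ U₂ ∣) (anti : Anticomplete H U₁ U₂) where

  private
    F = extremalOrder k

  ∣U∣≤ : ∀ b a₁ a₂ → ∣ U₁ ∣ ≤ F b a₁ → ∣ U₂ ∣ ≤ F b a₂ → ∣ U ∣ ≤ F b (a₁ + a₂)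
  ∣U∣≤ b a₁ a₂ bound₁ bound₂ = begin
    ∣ U ∣              ≡⟨ ∣U∣≡ ⟩
    ∣ U₁ ∣ + ∣ U₂ ∣    ≤⟨ +-mono-≤ bound₁ bound₂ ⟩
    F b a₁ + F b a₂    ≤⟨ extremalOrder-superadditiveʳ k b a₁ a₂ ⟩
    F b (a₁ + a₂)      ∎
    where open ≤-Reasoning

  record United (A₁ A₂ : Subset n) : Set where
    field
      ∪⊆U : A₁ ∪ A₂ ⊆ U
      ∪-ok : MaxDegInducedLE H k (A₁ ∪ A₂)
      ∣∪∣ : ∣ A₁ ∪ A₂ ∣ ≡ ∣ A₁ ∣ + ∣ A₂ ∣

  unite : ∀ {A₁ A₂} → A₁ ⊆ U₁ → A₂ ⊆ U₂ → MaxDegInducedLE H k A₁ → MaxDegInducedLE H k A₂ → United A₁ A₂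
  unite {A₁} {A₂} A₁⊆U₁ A₂⊆U₂ ok₁ ok₂ = record
    { ∪⊆U  = λ x∈A → Data.Sum.[ U₁⊆U ∘ A₁⊆U₁ , U₂⊆U ∘ A₂⊆U₂ ] (x∈p∪q⁻ A₁ A₂ x∈A)
    ; ∪-ok = MaxDegInducedLE-∪ H k (λ u∈A₁ v∈A₂ → anti (A₁⊆U₁ u∈A₁) (A₂⊆U₂ v∈A₂)) ok₁ ok₂
    ; ∣∪∣  = ∣p∪q∣≡∣p∣+∣q∣ A₁ A₂ (λ x∈A₁ x∈A₂ → disjoint (A₁⊆U₁ x∈A₁) (A₂⊆U₂ x∈A₂)) }

  both : Witness k H H′ U₁ → Witness k H H′ U₂ → Witness k H H′ U
  both w₁ w₂ = pick (∣ W₁.dense ∣ ≤? ∣ W₂.dense ∣)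
    where
    module W₁ = Witness w₁
    module W₂ = Witness w₂
    open United (unite W₁.sparse⊆U W₂.sparse⊆U W₁.sparse-ok W₂.sparse-ok)
    with-dense : ∀ B → B ⊆ U → MaxDegInducedLE H′ k B → suc k ≤ ∣ B ∣ →
      ∣ W₁.dense ∣ ≤ ∣ B ∣ → ∣ W₂.dense ∣ ≤ ∣ B ∣ → Witness k H H′ U
    with-dense B B⊆U B-ok B-large B₁≤B B₂≤B = record
      { sparse = W₁.sparse ∪ W₂.sparse ; dense = B ; sparse⊆U = ∪⊆U ; dense⊆U = B⊆U
      ; sparse-ok = ∪-ok ; dense-ok = B-ok
      ; sparse-large = ≤-trans W₁.sparse-large (subst (∣ W₁.sparse ∣ ≤_) (sym ∣∪∣) (m≤m+n _ _))
      ; dense-large = B-large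
      ; bound = subst (λ a → ∣ U ∣ ≤ F ∣ B ∣ a) (sym ∣∪∣) (∣U∣≤ (∣ B ∣) (∣ W₁.sparse ∣) (∣ W₂.sparse ∣)
          (≤-trans W₁.bound (extremalOrder-monoˡ-≤ k ∣ W₁.sparse ∣ B₁≤B))
          (≤-trans W₂.bound (extremalOrder-monoˡ-≤ k ∣ W₂.sparse ∣ B₂≤B))) }
    pick : Dec (∣ W₁.dense ∣ ≤ ∣ W₂.dense ∣) → Witness k H H′ U
    pick (yes B₁≤B₂) = with-dense W₂.dense (U₂⊆U ∘ W₂.dense⊆U) W₂.dense-ok W₂.dense-large B₁≤B₂ ≤-refl
    pick (no B₁≰B₂)  = with-dense W₁.dense (U₁⊆U ∘ W₁.dense⊆U) W₁.dense-ok W₁.dense-large ≤-refl (≰⇒≥ B₁≰B₂)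

  one : Witness k H H′ U₁ → ∣ U₂ ∣ ≤ k → Witness k H H′ U
  one w₁ small₂ = record
    { sparse = W₁.sparse ∪ U₂ ; dense = W₁.dense ; sparse⊆U = ∪⊆U ; dense⊆U = U₁⊆U ∘ W₁.dense⊆U
    ; sparse-ok = ∪-ok ; dense-ok = W₁.dense-ok
    ; sparse-large = ≤-trans W₁.sparse-large (subst (∣ W₁.sparse ∣ ≤_) (sym ∣∪∣) (m≤m+n _ _))
    ; dense-large = W₁.dense-large
    ; bound = subst (λ a → ∣ U ∣ ≤ F ∣ W₁.dense ∣ a) (sym ∣∪∣) (∣U∣≤ (∣ W₁.dense ∣) (∣ W₁.sparse ∣) (∣ U₂ ∣)
        W₁.bound (≤-extremalOrder k (∣ W₁.dense ∣) (∣ U₂ ∣) W₁.dense-large)) }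
    where
    module W₁ = Witness w₁
    open United (unite W₁.sparse⊆U (λ x → x) W₁.sparse-ok (MaxDegInducedLE-small H k U₂ (m≤n⇒m≤1+n small₂)))

  neither : ∣ U₁ ∣ ≤ k → ∣ U₂ ∣ ≤ k → suc k ≤ ∣ U ∣ → Witness k H H′ U
  neither small₁ small₂ large with subset-of-size (suc k) U large
  ... | B , B⊆U , ∣B∣≡1+k = record
    { sparse = U₁ ∪ U₂ ; dense = B ; sparse⊆U = ∪⊆U ; dense⊆U = B⊆U
    ; sparse-ok = ∪-ok ; dense-ok = MaxDegInducedLE-small H′ k B (≤-reflexive ∣B∣≡1+k)
    ; sparse-large = subst (suc k ≤_) ∣U∣≡∣∪∣ large
    ; dense-large = ≤-reflexive (sym ∣B∣≡1+k)
    ; bound = subst (λ a → ∣ U ∣ ≤ F ∣ B ∣ a) ∣U∣≡∣∪∣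
        (≤-extremalOrder k (∣ B ∣) (∣ U ∣) (≤-reflexive (sym ∣B∣≡1+k))) }
    where
    open United (unite (λ x → x) (λ x → x) (MaxDegInducedLE-small H k U₁ (m≤n⇒m≤1+n small₁))
                                           (MaxDegInducedLE-small H k U₂ (m≤n⇒m≤1+n small₂)))
    ∣U∣≡∣∪∣ : ∣ U ∣ ≡ ∣ U₁ ∪ U₂ ∣
    ∣U∣≡∣∪∣ = trans ∣U∣≡ (sym ∣∪∣)

combine : ∀ k (H H′ : Graph n) {U U₁ U₂ : Subset n} → U₁ ⊆ U → U₂ ⊆ U → Disjoint U₁ U₂ →
  ∣ U ∣ ≡ ∣ U₁ ∣ + ∣ U₂ ∣ → Anticomplete H U₁ U₂ →
  ∣ U₁ ∣ ≤ k ⊎ Witness k H H′ U₁ → ∣ U₂ ∣ ≤ k ⊎ Witness k H H′ U₂ → suc k ≤ ∣ U ∣ → Witness k H H′ U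
combine k H H′ U₁⊆U U₂⊆U disjoint ∣U∣≡ anti (inj₂ w₁) (inj₂ w₂) _ =
  Combine.both k H H′ U₁⊆U U₂⊆U disjoint ∣U∣≡ anti w₁ w₂
combine k H H′ U₁⊆U U₂⊆U disjoint ∣U∣≡ anti (inj₂ w₁) (inj₁ small₂) _ =
  Combine.one k H H′ U₁⊆U U₂⊆U disjoint ∣U∣≡ anti w₁ small₂
combine k H H′ {U₁ = U₁} {U₂} U₁⊆U U₂⊆U disjoint ∣U∣≡ anti (inj₁ small₁) (inj₂ w₂) _ =
  Combine.one k H H′ U₂⊆U U₁⊆U (λ x∈U₂ x∈U₁ → disjoint x∈U₁ x∈U₂) (trans ∣U∣≡ (+-comm ∣ U₁ ∣ ∣ U₂ ∣))
    (anticomplete-sym H anti) w₂ small₁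
combine k H H′ U₁⊆U U₂⊆U disjoint ∣U∣≡ anti (inj₁ small₁) (inj₁ small₂) large =
  Combine.neither k H H′ U₁⊆U U₂⊆U disjoint ∣U∣≡ anti small₁ small₂ large

witness : ∀ k {G : Graph n} → IsCograph G → ∀ m (U : Subset n) → ∣ U ∣ ≤ m → suc k ≤ ∣ U ∣ →
  Witness k G (complement G) U
witness k cograph zero U ∣U∣≤0 large = ⊥-elim (<⇒≱ (≤-trans (s≤s z≤n) large) ∣U∣≤0)
witness k {G} cograph (suc m) U ∣U∣≤1+m large with ∣ U ∣ ≤? suc k
... | yes small = record
  { sparse = U ; dense = U ; sparse⊆U = λ x → x ; dense⊆U = λ x → x
  ; sparse-ok = MaxDegInducedLE-small G k U small ; dense-ok = MaxDegInducedLE-small (complement G) k U small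
  ; sparse-large = large ; dense-large = large ; bound = ≤-extremalOrder k (∣ U ∣) (∣ U ∣) large }
... | no big = by-side homogeneous
  where
  open Split (split {G = G} cograph (suc m) U ∣U∣≤1+m (≤-trans (s≤s (s≤s z≤n)) (≰⇒> big)))
  rest = U ─ part
  disjoint = q∩p─q≡∅ U part
  ∣U∣≡ : ∣ U ∣ ≡ ∣ part ∣ + ∣ rest ∣
  ∣U∣≡ = ∣p∣≡∣q∣+∣p─q∣ U part part⊆U
  ∣part∣≤m : ∣ part ∣ ≤ m
  ∣part∣≤m = ≤-pred (≤-trans (subst (∣ part ∣ <_) (sym ∣U∣≡) (m<m+n _ (nonempty⇒∣p∣>0 rest-nonempty))) ∣U∣≤1+m)
  ∣rest∣≤m : ∣ rest ∣ ≤ m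
  ∣rest∣≤m = ≤-pred (≤-trans (subst (∣ rest ∣ <_) (sym ∣U∣≡) (m<n+m _ (nonempty⇒∣p∣>0 part-nonempty))) ∣U∣≤1+m)
  piece : ∀ V → ∣ V ∣ ≤ m → ∣ V ∣ ≤ k ⊎ Witness k G (complement G) V
  piece V ∣V∣≤m with suc k ≤? ∣ V ∣
  ... | yes V-large = inj₂ (witness k cograph m V ∣V∣≤m V-large)
  ... | no  V-small = inj₁ (≤-pred (≰⇒> V-small))
  by-side : Anticomplete G part rest ⊎ Complete G part rest → Witness k G (complement G) U
  by-side (inj₁ anti) = combine k G (complement G) part⊆U (p─q⊆p U part) disjoint ∣U∣≡ anti
    (piece part ∣part∣≤m) (piece rest ∣rest∣≤m) large
  by-side (inj₂ comp) = witness-swap (combine k (complement G) G part⊆U (p─q⊆p U part) disjoint ∣U∣≡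
    (complete⇒anticomplete-complement G disjoint comp)
    (Data.Sum.map₂ witness-swap (piece part ∣part∣≤m)) (Data.Sum.map₂ witness-swap (piece rest ∣rest∣≤m)) large)

sparseSet-⊆ : ∀ (H : Graph n) k j {S} → MaxDegInducedLE H k S → j ≤ ∣ S ∣ → ∃ λ T → IsSparseSet H k j T
sparseSet-⊆ H k j {S} md j≤∣S∣ with subset-of-size j S j≤∣S∣
... | T , T⊆S , ∣T∣≡j = T , ∣T∣≡j , MaxDegInducedLE-⊆ H k T⊆S md

coRamseyProp-extremalOrder : ∀ k x y → suc k ≤ x → suc k ≤ y →
  CoRamseyProp k (suc x) (suc y) (suc (extremalOrder k x y))
coRamseyProp-extremalOrder k x y k<x k<y G cograph = by-sizes (suc x ≤? ∣ dense ∣) (suc y ≤? ∣ sparse ∣)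
  where
  N = suc (extremalOrder k x y)
  large : suc k ≤ ∣ ⊤ {N} ∣
  large = subst (suc k ≤_) (sym (∣⊤∣≡n N)) (≤-trans k<y (m≤n⇒m≤1+n (≤-extremalOrder k x y k<x)))
  open Witness (witness k cograph N ⊤ (≤-reflexive (∣⊤∣≡n N)) large)
  by-sizes : Dec (suc x ≤ ∣ dense ∣) → Dec (suc y ≤ ∣ sparse ∣) →
    (∃ λ S → IsDenseSet G k (suc x) S) ⊎ (∃ λ S → IsSparseSet G k (suc y) S)
  by-sizes (yes x<∣B∣) _         = inj₁ (sparseSet-⊆ (complement G) k (suc x) dense-ok x<∣B∣)
  by-sizes _         (yes y<∣A∣) = inj₂ (sparseSet-⊆ G k (suc y) sparse-ok y<∣A∣)
  by-sizes (no x≮∣B∣) (no y≮∣A∣) = ⊥-elim (1+n≰n (begin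
    N                                         ≡⟨ ∣⊤∣≡n N ⟨
    ∣ ⊤ {N} ∣                                 ≤⟨ bound ⟩
    extremalOrder k (∣ dense ∣) (∣ sparse ∣)  ≤⟨ extremalOrder-mono-≤ k (≤-pred (≰⇒> x≮∣B∣)) (≤-pred (≰⇒> y≮∣A∣)) ⟩
    extremalOrder k x y                       ∎))
    where open ≤-Reasoning

-- Sums of graphs

IsComplete : Graph n → Set
IsComplete G = ∀ {u v} → u ≢ v → adj G u v ≡ true

edgeless : ∀ n → Graph n
edgeless n = record { adj = λ _ _ → false ; sym = λ _ _ → refl ; irref = λ _ → refl }

complete : ∀ n → Graph n
complete n = complement (edgeless n)

complete-isComplete : IsComplete (complete n)
complete-isComplete = complement-adj (edgeless _)

Embeds : ∀ {m} → (Fin m → Fin n) → Graph m → Graph n → Set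
Embeds f G X = ∀ x y → adj X (f x) (f y) ≡ adj G x y

complement-embeds : ∀ {m} {f : Fin m → Fin n} {G X} → (∀ {x y} → f x ≡ f y → x ≡ y) →
  Embeds f G X → Embeds f (complement G) (complement X)
complement-embeds {f = f} {G} {X} f-inj emb x y = by-cases (x ≟ᶠ y)
  where
  open ≡-Reasoning
  by-cases : Dec (x ≡ y) → adj (complement X) (f x) (f y) ≡ adj (complement G) x y
  by-cases (yes refl) = trans (irref (complement X) (f x)) (sym (irref (complement G) x))
  by-cases (no x≢y)   = begin
    adj (complement X) (f x) (f y)   ≡⟨ complement-adj X (x≢y ∘ f-inj) ⟩
    not (adj X (f x) (f y))          ≡⟨ cong not (emb x y) ⟩
    not (adj G x y)                  ≡⟨ complement-adj G x≢y ⟨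
    adj (complement G) x y           ∎

record IsSum (c : Bool) {a b} (X : Graph (a + b)) (G : Graph a) (H : Graph b) : Set where
  field
    left  : Embeds (_↑ˡ b) G X
    right : Embeds (a ↑ʳ_) H X
    cross : ∀ x y → adj X (x ↑ˡ b) (a ↑ʳ y) ≡ c
open IsSum

sumAdj : Bool → (Fin a → Fin a → Bool) → (Fin b → Fin b → Bool) → Fin a ⊎ Fin b → Fin a ⊎ Fin b → Bool
sumAdj c f g (inj₁ x) (inj₁ y) = f x y
sumAdj c f g (inj₂ x) (inj₂ y) = g x y
sumAdj c f g _        _        = c

sum : Bool → Graph a → Graph b → Graph (a + b)
sum {a} c G H = record
  { adj   = λ u v → sumAdj c (adj G) (adj H) (splitAt a u) (splitAt a v)
  ; sym   = λ u v → sumAdj-sym (splitAt a u) (splitAt a v)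
  ; irref = λ v → sumAdj-irref (splitAt a v)
  }
  where
  sumAdj-sym : ∀ s t → sumAdj c (adj G) (adj H) s t ≡ sumAdj c (adj G) (adj H) t s
  sumAdj-sym (inj₁ x) (inj₁ y) = Graph.sym G x y
  sumAdj-sym (inj₁ x) (inj₂ y) = refl
  sumAdj-sym (inj₂ x) (inj₁ y) = refl
  sumAdj-sym (inj₂ x) (inj₂ y) = Graph.sym H x y
  sumAdj-irref : ∀ s → sumAdj c (adj G) (adj H) s s ≡ false
  sumAdj-irref (inj₁ x) = irref G x
  sumAdj-irref (inj₂ y) = irref H y

union join : Graph a → Graph b → Graph (a + b)
union = sum false
join  = sum true

sum-isSum : ∀ c (G : Graph a) (H : Graph b) → IsSum c (sum c G H) G H
sum-isSum {a} {b} c G H = record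
  { left  = λ x y → cong₂ (sumAdj c (adj G) (adj H)) (splitAt-↑ˡ a x b) (splitAt-↑ˡ a y b)
  ; right = λ x y → cong₂ (sumAdj c (adj G) (adj H)) (splitAt-↑ʳ a b x) (splitAt-↑ʳ a b y)
  ; cross = λ x y → cong₂ (sumAdj c (adj G) (adj H)) (splitAt-↑ˡ a x b) (splitAt-↑ʳ a b y)
  }

↑ˡ≢↑ʳ : ∀ {a b} (x : Fin a) (y : Fin b) → x ↑ˡ b ≢ a ↑ʳ y
↑ˡ≢↑ʳ {a} {b} x y e with trans (sym (splitAt-↑ˡ a x b)) (trans (cong (splitAt a) e) (splitAt-↑ʳ a b y))
... | ()

cross-sym : ∀ {c} {X : Graph (a + b)} {G : Graph a} {H : Graph b} (s : IsSum c X G H) →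
  ∀ x y → adj X (a ↑ʳ y) (x ↑ˡ b) ≡ c
cross-sym {X = X} s x y = trans (Graph.sym X _ _) (cross s x y)

complement-isSum : ∀ {c} {X : Graph (a + b)} {G : Graph a} {H : Graph b} → IsSum c X G H →
  IsSum (not c) (complement X) (complement G) (complement H)
complement-isSum {a} {b} {X = X} s = record
  { left  = complement-embeds (↑ˡ-injective b _ _) (left s)
  ; right = complement-embeds (↑ʳ-injective a _ _) (right s)
  ; cross = λ x y → trans (complement-adj X (↑ˡ≢↑ʳ x y)) (cong not (cross s x y))
  }

nbhd-↑ˡ : ∀ {X : Graph (a + b)} {G : Graph a} → Embeds (_↑ˡ b) G X →
  ∀ x → nbhd X (x ↑ˡ b) ≡ nbhd G x ++ tabulate (λ y → adj X (x ↑ˡ b) (a ↑ʳ y))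
nbhd-↑ˡ {a} {X = X} emb x = trans (tabulate-++ a (adj X (x ↑ˡ _))) (cong (_++ _) (tabulate-cong (emb x)))

module _ {c} {X : Graph (a + b)} {G : Graph a} {H : Graph b} (s : IsSum c X G H) where

  nbhd-sum-↑ˡ : ∀ x → nbhd X (x ↑ˡ b) ≡ nbhd G x ++ replicate b c
  nbhd-sum-↑ˡ x = trans (nbhd-↑ˡ {X = X} {G = G} (left s) x)
    (cong (nbhd G x ++_) (trans (tabulate-cong (cross s x)) (tabulate-const b c)))

  nbhd-sum-↑ʳ : ∀ y → nbhd X (a ↑ʳ y) ≡ replicate a c ++ nbhd H y
  nbhd-sum-↑ʳ y = trans (tabulate-++ a (adj X (a ↑ʳ y)))
    (cong₂ _++_ (trans (tabulate-cong (λ x → cross-sym s x y)) (tabulate-const a c))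
                (tabulate-cong (right s y)))

  degree-↑ˡ : ∀ (p : Subset a) (q : Subset b) x →
    ∣ (p ++ q) ∩ nbhd X (x ↑ˡ b) ∣ ≡ ∣ q ∩ replicate b c ∣ + ∣ p ∩ nbhd G x ∣
  degree-↑ˡ p q x = begin
    ∣ (p ++ q) ∩ nbhd X (x ↑ˡ b) ∣                     ≡⟨ cong (λ N → ∣ (p ++ q) ∩ N ∣) (nbhd-sum-↑ˡ x) ⟩
    ∣ (p ++ q) ∩ (nbhd G x ++ replicate b c) ∣         ≡⟨ cong ∣_∣ (∩-++ p (nbhd G x) q (replicate b c)) ⟩
    ∣ (p ∩ nbhd G x) ++ (q ∩ replicate b c) ∣          ≡⟨ ∣p++q∣ (p ∩ nbhd G x) (q ∩ replicate b c) ⟩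
    ∣ p ∩ nbhd G x ∣ + ∣ q ∩ replicate b c ∣           ≡⟨ +-comm ∣ p ∩ nbhd G x ∣ _ ⟩
    ∣ q ∩ replicate b c ∣ + ∣ p ∩ nbhd G x ∣           ∎
    where open ≡-Reasoning

  degree-↑ʳ : ∀ (p : Subset a) (q : Subset b) y →
    ∣ (p ++ q) ∩ nbhd X (a ↑ʳ y) ∣ ≡ ∣ p ∩ replicate a c ∣ + ∣ q ∩ nbhd H y ∣
  degree-↑ʳ p q y = begin
    ∣ (p ++ q) ∩ nbhd X (a ↑ʳ y) ∣                     ≡⟨ cong (λ N → ∣ (p ++ q) ∩ N ∣) (nbhd-sum-↑ʳ y) ⟩
    ∣ (p ++ q) ∩ (replicate a c ++ nbhd H y) ∣         ≡⟨ cong ∣_∣ (∩-++ p (replicate a c) q (nbhd H y)) ⟩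
    ∣ (p ∩ replicate a c) ++ (q ∩ nbhd H y) ∣          ≡⟨ ∣p++q∣ (p ∩ replicate a c) (q ∩ nbhd H y) ⟩
    ∣ p ∩ replicate a c ∣ + ∣ q ∩ nbhd H y ∣           ∎
    where open ≡-Reasoning

-- S induces maximum degree at most k ∸ e, stated without truncated subtraction.
MaxDegInducedPlusLE : Graph n → ℕ → ℕ → Subset n → Set
MaxDegInducedPlusLE G e k S = ∀ v → v ∈ S → e + ∣ S ∩ nbhd G v ∣ ≤ k

MaxDegInducedPlusLE⇒MaxDegInducedLE : ∀ (G : Graph n) e {k} S →
  MaxDegInducedPlusLE G e k S → MaxDegInducedLE G k S
MaxDegInducedPlusLE⇒MaxDegInducedLE G e S md v v∈S = m+n≤o⇒n≤o e (md v v∈S)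

module _ {c} {X : Graph (a + b)} {G : Graph a} {H : Graph b} (s : IsSum c X G H) {e k : ℕ} (p : Subset a) (q : Subset b) where

  restrictˡ : MaxDegInducedPlusLE X e k (p ++ q) → MaxDegInducedPlusLE G (e + ∣ q ∩ replicate b c ∣) k p
  restrictˡ md x x∈p = subst (_≤ k) (trans (cong (e +_) (degree-↑ˡ s p q x)) (sym (+-assoc e _ _)))
    (md (x ↑ˡ b) (∈-++⁺ˡ q x∈p))

  restrictʳ : MaxDegInducedPlusLE X e k (p ++ q) → MaxDegInducedPlusLE H (e + ∣ p ∩ replicate a c ∣) k q
  restrictʳ md y y∈q = subst (_≤ k) (trans (cong (e +_) (degree-↑ʳ s p q y)) (sym (+-assoc e _ _)))
    (md (a ↑ʳ y) (∈-++⁺ʳ p y∈q))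

module _ {X : Graph (a + b)} {G : Graph a} {H : Graph b} {e k : ℕ} (p : Subset a) (q : Subset b) where

  union-restrictˡ : IsSum false X G H → MaxDegInducedPlusLE X e k (p ++ q) → MaxDegInducedPlusLE G e k p
  union-restrictˡ s md = subst (λ w → MaxDegInducedPlusLE G w k p)
    (trans (cong (e +_) (∣p∩replicate-false∣ q)) (+-identityʳ e)) (restrictˡ s p q md)

  union-restrictʳ : IsSum false X G H → MaxDegInducedPlusLE X e k (p ++ q) → MaxDegInducedPlusLE H e k q
  union-restrictʳ s md = subst (λ w → MaxDegInducedPlusLE H w k q)
    (trans (cong (e +_) (∣p∩replicate-false∣ p)) (+-identityʳ e)) (restrictʳ s p q md)

  join-restrictˡ : IsSum true X G H → MaxDegInducedPlusLE X e k (p ++ q) → MaxDegInducedPlusLE G (e + ∣ q ∣) k p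
  join-restrictˡ s md = subst (λ w → MaxDegInducedPlusLE G (e + w) k p) (∣p∩replicate-true∣ q) (restrictˡ s p q md)

  join-restrictʳ : IsSum true X G H → MaxDegInducedPlusLE X e k (p ++ q) → MaxDegInducedPlusLE H (e + ∣ p ∣) k q
  join-restrictʳ s md = subst (λ w → MaxDegInducedPlusLE H (e + w) k q) (∣p∩replicate-true∣ p) (restrictʳ s p q md)

SparseSetsAtMost : Graph n → ℕ → ℕ → Set
SparseSetsAtMost G k s = ∀ S → MaxDegInducedLE G k S → ∣ S ∣ ≤ s

-- Across a join, the other side uses up e of the degree budget of a sparse set.
SparseSetsPlusAtMost : Graph n → ℕ → ℕ → Set
SparseSetsPlusAtMost G k s = ∀ e S → Nonempty S → MaxDegInducedPlusLE G e k S → e + ∣ S ∣ ≤ s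

module _ (G : Graph n) {k : ℕ} where

  sparseSetsAtMost-mono : ∀ {s s′} → s ≤ s′ → SparseSetsAtMost G k s → SparseSetsAtMost G k s′
  sparseSetsAtMost-mono s≤s′ bound S md = ≤-trans (bound S md) s≤s′

  sparseSetsPlusAtMost-mono : ∀ {s s′} → s ≤ s′ → SparseSetsPlusAtMost G k s → SparseSetsPlusAtMost G k s′
  sparseSetsPlusAtMost-mono s≤s′ bound e S ne md = ≤-trans (bound e S ne md) s≤s′

  sparseSetsPlusAtMost⇒sparseSetsAtMost : ∀ {s} → SparseSetsPlusAtMost G k s → SparseSetsAtMost G k s
  sparseSetsPlusAtMost⇒sparseSetsAtMost bound S md with nonempty? S
  ... | yes ne = bound 0 S ne md
  ... | no ¬ne = subst (_≤ _) (sym (∣empty∣ ¬ne)) z≤n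

  sparseSetsAtMost-order : SparseSetsAtMost G k n
  sparseSetsAtMost-order S _ = ∣p∣≤n S

  sparseSetsPlusAtMost-order : SparseSetsPlusAtMost G k (k + n)
  sparseSetsPlusAtMost-order e S (v , v∈S) md = +-mono-≤ (m+n≤o⇒m≤o e (md v v∈S)) (∣p∣≤n S)

  sparseSetsPlusAtMost-complete : IsComplete G → SparseSetsPlusAtMost G k (suc k)
  sparseSetsPlusAtMost-complete G-complete e S (v , v∈S) md = begin
    e + ∣ S ∣                    ≤⟨ +-monoʳ-≤ e ∣S∣≤1+degree ⟩
    e + suc ∣ S ∩ nbhd G v ∣     ≡⟨ +-suc e _ ⟩
    suc (e + ∣ S ∩ nbhd G v ∣)   ≤⟨ s≤s (md v v∈S) ⟩
    suc k                        ∎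
    where
    open ≤-Reasoning
    S⊆v∪N : S ⊆ ⁅ v ⁆ ∪ (S ∩ nbhd G v)
    S⊆v∪N {u} u∈S with u ≟ᶠ v
    ... | yes refl = x∈p∪q⁺ (inj₁ (x∈⁅x⁆ v))
    ... | no u≢v   = x∈p∪q⁺ (inj₂ (x∈p∩q⁺ (u∈S , ∈-nbhd⁺ G (G-complete (u≢v ∘ sym)))))
    ∣S∣≤1+degree : ∣ S ∣ ≤ suc ∣ S ∩ nbhd G v ∣
    ∣S∣≤1+degree = ≤-trans (p⊆q⇒∣p∣≤∣q∣ S⊆v∪N)
      (≤-trans (∣p∪q∣≤∣p∣+∣q∣ ⁅ v ⁆ _) (≤-reflexive (cong (_+ ∣ S ∩ nbhd G v ∣) (∣⁅x⁆∣≡1 v))))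

module _ {X : Graph (a + b)} {G : Graph a} {H : Graph b} {k s t : ℕ} where

  sparseSetsAtMost-union : IsSum false X G H → SparseSetsAtMost G k s → SparseSetsAtMost H k t →
    SparseSetsAtMost X k (s + t)
  sparseSetsAtMost-union X=G⊔H boundG boundH = subset-++-elim bound
    where
    bound : ∀ p q → MaxDegInducedLE X k (p ++ q) → ∣ p ++ q ∣ ≤ s + t
    bound p q md = subst (_≤ s + t) (sym (∣p++q∣ p q))
      (+-mono-≤ (boundG p (union-restrictˡ {e = 0} p q X=G⊔H md)) (boundH q (union-restrictʳ {e = 0} p q X=G⊔H md)))

  sparseSetsPlusAtMost-union : IsSum false X G H → SparseSetsPlusAtMost G k s → SparseSetsAtMost H k t →
    SparseSetsPlusAtMost H k (s + t) → SparseSetsPlusAtMost X k (s + t)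
  sparseSetsPlusAtMost-union X=G⊔H boundG boundH boundH⁺ e = subset-++-elim bound
    where
    bound : ∀ p q → Nonempty (p ++ q) → MaxDegInducedPlusLE X e k (p ++ q) → e + ∣ p ++ q ∣ ≤ s + t
    bound p q ne md with nonempty? p
    ... | yes p≠∅ = begin
      e + ∣ p ++ q ∣          ≡⟨ trans (cong (e +_) (∣p++q∣ p q)) (sym (+-assoc e _ _)) ⟩
      e + ∣ p ∣ + ∣ q ∣       ≤⟨ +-mono-≤ (boundG e p p≠∅ (union-restrictˡ p q X=G⊔H md))
                                   (boundH q (MaxDegInducedPlusLE⇒MaxDegInducedLE H e q
                                     (union-restrictʳ p q X=G⊔H md))) ⟩
      s + t                   ∎
      where open ≤-Reasoning
    ... | no p=∅ with nonempty-++⁻ p ne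
    ...   | inj₁ p≠∅ = ⊥-elim (p=∅ p≠∅)
    ...   | inj₂ q≠∅ = subst (λ w → e + w ≤ s + t) (sym (trans (∣p++q∣ p q) (cong (_+ ∣ q ∣) (∣empty∣ p=∅))))
                         (boundH⁺ e q q≠∅ (union-restrictʳ p q X=G⊔H md))

module _ {X : Graph (a + b)} {G : Graph a} {H : Graph b} {k s : ℕ} where

  sparseSetsAtMost-join : IsSum true X G H → SparseSetsAtMost G k s → SparseSetsPlusAtMost H k s →
    SparseSetsAtMost X k s
  sparseSetsAtMost-join X=G⋈H boundG boundH⁺ = subset-++-elim bound
    where
    bound : ∀ p q → MaxDegInducedLE X k (p ++ q) → ∣ p ++ q ∣ ≤ s
    bound p q md with nonempty? q
    ... | yes q≠∅ = subst (_≤ s) (sym (∣p++q∣ p q)) (boundH⁺ ∣ p ∣ q q≠∅ (join-restrictʳ {e = 0} p q X=G⋈H md))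
    ... | no q=∅  = subst (_≤ s) (sym (trans (∣p++q∣ p q) (trans (cong (∣ p ∣ +_) (∣empty∣ q=∅)) (+-identityʳ _))))
                      (boundG p (MaxDegInducedPlusLE⇒MaxDegInducedLE G ∣ q ∣ p (join-restrictˡ {e = 0} p q X=G⋈H md)))

IsP4 : Graph n → Fin n → Fin n → Fin n → Fin n → Set
IsP4 G a b c d =
  (a ≢ b) × (a ≢ c) × (a ≢ d) × (b ≢ c) × (b ≢ d) × (c ≢ d) ×
  (adj G a b ≡ true) × (adj G b c ≡ true) × (adj G c d ≡ true) ×
  (adj G a c ≡ false) × (adj G b d ≡ false) × (adj G a d ≡ false)

module _ {m} {f : Fin m → Fin n} {G : Graph m} {X : Graph n} (emb : Embeds f G X) where

  isP4-reflect : ∀ {a b c d} → IsP4 X (f a) (f b) (f c) (f d) → IsP4 G a b c d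
  isP4-reflect {a} {b} {c} {d} (ab , ac , ad , bc , bd , cd , eab , ebc , ecd , eac , ebd , ead) =
    ab ∘ cong f , ac ∘ cong f , ad ∘ cong f , bc ∘ cong f , bd ∘ cong f , cd ∘ cong f ,
    trans (sym (emb a b)) eab , trans (sym (emb b c)) ebc , trans (sym (emb c d)) ecd ,
    trans (sym (emb a c)) eac , trans (sym (emb b d)) ebd , trans (sym (emb a d)) ead

  isP4-embed : (∀ {x y} → f x ≡ f y → x ≡ y) → ∀ {a b c d} → IsP4 G a b c d → IsP4 X (f a) (f b) (f c) (f d)
  isP4-embed f-inj {a} {b} {c} {d} (ab , ac , ad , bc , bd , cd , eab , ebc , ecd , eac , ebd , ead) =
    ab ∘ f-inj , ac ∘ f-inj , ad ∘ f-inj , bc ∘ f-inj , bd ∘ f-inj , cd ∘ f-inj ,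
    trans (emb a b) eab , trans (emb b c) ebc , trans (emb c d) ecd ,
    trans (emb a c) eac , trans (emb b d) ebd , trans (emb a d) ead

  isCograph-embeds : (∀ {x y} → f x ≡ f y → x ≡ y) → IsCograph X → IsCograph G
  isCograph-embeds f-inj cograph (a , b , c , d , P) = cograph (f a , f b , f c , f d , isP4-embed f-inj P)

data SumView (a b : ℕ) : Fin (a + b) → Set where
  inˡ : ∀ x → SumView a b (x ↑ˡ b)
  inʳ : ∀ y → SumView a b (a ↑ʳ y)

sumView : ∀ a {b} u → SumView a b u
sumView zero    u       = inʳ u
sumView (suc a) zero    = inˡ zero
sumView (suc a) (suc u) with sumView a u
... | inˡ x = inˡ (suc x)
... | inʳ y = inʳ y

module _ {X : Graph (a + b)} {G : Graph a} {H : Graph b} where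

  isCograph-union : IsSum false X G H → IsCograph G → IsCograph H → IsCograph X
  isCograph-union s cG cH (u₁ , u₂ , u₃ , u₄ , P@(_ , _ , _ , _ , _ , _ , e₁₂ , e₂₃ , e₃₄ , _))
    with sumView a u₁ | sumView a u₂ | sumView a u₃ | sumView a u₄
  ... | inˡ x₁ | inˡ x₂ | inˡ x₃ | inˡ x₄ = cG (x₁ , x₂ , x₃ , x₄ , isP4-reflect {G = G} {X = X} (left s) P)
  ... | inʳ y₁ | inʳ y₂ | inʳ y₃ | inʳ y₄ = cH (y₁ , y₂ , y₃ , y₄ , isP4-reflect {G = H} {X = X} (right s) P)
  ... | inˡ x | inʳ y | _     | _     = true≢false e₁₂ (cross s x y)
  ... | inʳ y | inˡ x | _     | _     = true≢false e₁₂ (cross-sym s x y)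
  ... | _     | inˡ x | inʳ y | _     = true≢false e₂₃ (cross s x y)
  ... | _     | inʳ y | inˡ x | _     = true≢false e₂₃ (cross-sym s x y)
  ... | _     | _     | inˡ x | inʳ y = true≢false e₃₄ (cross s x y)
  ... | _     | _     | inʳ y | inˡ x = true≢false e₃₄ (cross-sym s x y)

  isCograph-join : IsSum true X G H → IsCograph G → IsCograph H → IsCograph X
  isCograph-join s cG cH (u₁ , u₂ , u₃ , u₄ , P@(_ , _ , _ , _ , _ , _ , _ , _ , _ , n₁₃ , n₂₄ , n₁₄))
    with sumView a u₁ | sumView a u₂ | sumView a u₃ | sumView a u₄
  ... | inˡ x₁ | inˡ x₂ | inˡ x₃ | inˡ x₄ = cG (x₁ , x₂ , x₃ , x₄ , isP4-reflect {G = G} {X = X} (left s) P)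
  ... | inʳ y₁ | inʳ y₂ | inʳ y₃ | inʳ y₄ = cH (y₁ , y₂ , y₃ , y₄ , isP4-reflect {G = H} {X = X} (right s) P)
  ... | inˡ x | _     | inʳ y | _     = true≢false (cross s x y) n₁₃
  ... | inʳ y | _     | inˡ x | _     = true≢false (cross-sym s x y) n₁₃
  ... | _     | inˡ x | _     | inʳ y = true≢false (cross s x y) n₂₄
  ... | _     | inʳ y | _     | inˡ x = true≢false (cross-sym s x y) n₂₄
  ... | inˡ x | _     | _     | inʳ y = true≢false (cross s x y) n₁₄
  ... | inʳ y | _     | _     | inˡ x = true≢false (cross-sym s x y) n₁₄

isCograph-edgeless : IsCograph (edgeless n)
isCograph-edgeless (_ , _ , _ , _ , _ , _ , _ , _ , _ , _ , () , _)

isCograph-complete : IsCograph (complete n)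
isCograph-complete (_ , _ , _ , _ , _ , ac , _ , _ , _ , _ , _ , _ , _ , n₁₃ , _) =
  true≢false (complete-isComplete ac) n₁₃

isCograph-sum : ∀ {c} {X : Graph (a + b)} {G : Graph a} {H : Graph b} →
  IsSum c X G H → IsCograph G → IsCograph H → IsCograph X
isCograph-sum {c = false} = isCograph-union
isCograph-sum {c = true}  = isCograph-join

-- Lower bound

powerOrder : ℕ → ℕ → ℕ → ℕ
powerOrder n a zero    = n
powerOrder n a (suc j) = powerOrder n a j + a

sumPower : Bool → Graph n → Graph a → ∀ j → Graph (powerOrder n a j)
sumPower c G H zero    = G
sumPower c G H (suc j) = sum c (sumPower c G H j) H

module _ {c} {F : ∀ j → Graph (powerOrder n a j)} {H : Graph a} (chain : ∀ j → IsSum c (F (suc j)) (F j) H) where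

  isCograph-chain : IsCograph (F 0) → IsCograph H → ∀ j → IsCograph (F j)
  isCograph-chain cF cH zero    = cF
  isCograph-chain cF cH (suc j) = isCograph-sum (chain j) (isCograph-chain cF cH j) cH

module _ {k s t : ℕ} {F : ∀ j → Graph (powerOrder n a j)} {H : Graph a} where

  sparseSetsAtMost-unionChain : (∀ j → IsSum false (F (suc j)) (F j) H) →
    SparseSetsAtMost (F 0) k s → SparseSetsAtMost H k t → ∀ j → SparseSetsAtMost (F j) k (s + j * t)
  sparseSetsAtMost-unionChain chain boundF boundH zero    = sparseSetsAtMost-mono (F 0) (m≤m+n s 0) boundF
  sparseSetsAtMost-unionChain chain boundF boundH (suc j) =
    sparseSetsAtMost-mono (F (suc j)) (≤-reflexive (trans (+-assoc s (j * t) t) (cong (s +_) (+-comm (j * t) t))))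
      (sparseSetsAtMost-union (chain j) (sparseSetsAtMost-unionChain chain boundF boundH j) boundH)

module _ {k s : ℕ} {F : ∀ j → Graph (powerOrder n a j)} {H : Graph a} where

  sparseSetsAtMost-joinChain : (∀ j → IsSum true (F (suc j)) (F j) H) →
    SparseSetsAtMost (F 0) k s → SparseSetsPlusAtMost H k s → ∀ j → SparseSetsAtMost (F j) k s
  sparseSetsAtMost-joinChain chain boundF boundH zero    = boundF
  sparseSetsAtMost-joinChain chain boundF boundH (suc j) =
    sparseSetsAtMost-join (chain j) (sparseSetsAtMost-joinChain chain boundF boundH j) boundH

sumPower-chain : ∀ c (G : Graph n) (H : Graph a) j → IsSum c (sumPower c G H (suc j)) (sumPower c G H j) H
sumPower-chain c G H j = sum-isSum c (sumPower c G H j) H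

complement-sumPower-chain : ∀ c (G : Graph n) (H : Graph a) j →
  IsSum (not c) (complement (sumPower c G H (suc j))) (complement (sumPower c G H j)) (complement H)
complement-sumPower-chain c G H j = complement-isSum (sumPower-chain c G H j)

powerOrder-closed : ∀ n a j → powerOrder n a j ≡ n + j * a
powerOrder-closed n a zero    = sym (+-identityʳ n)
powerOrder-closed n a (suc j) = begin
  powerOrder n a j + a   ≡⟨ cong (_+ a) (powerOrder-closed n a j) ⟩
  n + j * a + a          ≡⟨ solve 3 (λ n a j → n :+ j :* a :+ a := n :+ (a :+ j :* a)) refl n a j ⟩
  n + suc j * a          ∎
  where open ≡-Reasoning

module Construction (k p q a′ b′ : ℕ) where

  private
    r = suc k

  block : ∀ c → Graph (c + q)
  block c = union (complete c) (edgeless q)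

  W : Graph (powerOrder (r + p + q) (r + q) a′)
  W = sumPower true (block (r + p)) (block r) a′

  P : Graph (r + (p + a′ * r))
  P = join (edgeless r) (complete (p + a′ * r))

  R : Graph (powerOrder (powerOrder (r + p + q) (r + q) a′) (r + (p + a′ * r)) b′)
  R = sumPower false W P b′

  block-sparse⁺ : ∀ c → SparseSetsPlusAtMost (block c) k (r + q)
  block-sparse⁺ c = sparseSetsPlusAtMost-union (sum-isSum false (complete c) (edgeless q))
    (sparseSetsPlusAtMost-complete (complete c) complete-isComplete) (sparseSetsAtMost-order (edgeless q))
    (sparseSetsPlusAtMost-mono (edgeless q) (+-monoˡ-≤ q (n≤1+n k)) (sparseSetsPlusAtMost-order (edgeless q)))

  block-dense : ∀ c → r ≤ c → SparseSetsAtMost (complement (block c)) k c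
  block-dense c r≤c = sparseSetsAtMost-join (complement-isSum (sum-isSum false (complete c) (edgeless q)))
    (sparseSetsAtMost-order (complement (complete c)))
    (sparseSetsPlusAtMost-mono (complete q) r≤c (sparseSetsPlusAtMost-complete (complete q) complete-isComplete))

  W-sparse : SparseSetsAtMost W k (r + q)
  W-sparse = sparseSetsAtMost-joinChain (sumPower-chain true (block (r + p)) (block r))
    (sparseSetsPlusAtMost⇒sparseSetsAtMost (block (r + p)) (block-sparse⁺ (r + p))) (block-sparse⁺ r) a′

  W-dense : SparseSetsAtMost (complement W) k (r + p + a′ * r)
  W-dense = sparseSetsAtMost-unionChain (complement-sumPower-chain true (block (r + p)) (block r))
    (block-dense (r + p) (m≤m+n r p)) (block-dense r ≤-refl) a′

  P-sparse : SparseSetsAtMost P k r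
  P-sparse = sparseSetsAtMost-join (sum-isSum true (edgeless r) (complete (p + a′ * r)))
    (sparseSetsAtMost-order (edgeless r)) (sparseSetsPlusAtMost-complete (complete (p + a′ * r)) complete-isComplete)

  P-dense⁺ : SparseSetsPlusAtMost (complement P) k (r + (p + a′ * r))
  P-dense⁺ = sparseSetsPlusAtMost-union (complement-isSum (sum-isSum true (edgeless r) (complete (p + a′ * r))))
    (sparseSetsPlusAtMost-complete (complete r) complete-isComplete)
    (sparseSetsAtMost-order (complement (complete (p + a′ * r))))
    (sparseSetsPlusAtMost-mono (complement (complete (p + a′ * r))) (+-monoˡ-≤ _ (n≤1+n k))
      (sparseSetsPlusAtMost-order (complement (complete (p + a′ * r)))))

  R-sparse : SparseSetsAtMost R k (r + q + b′ * r)
  R-sparse = sparseSetsAtMost-unionChain (sumPower-chain false W P) W-sparse P-sparse b′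

  R-dense : SparseSetsAtMost (complement R) k (r + (p + a′ * r))
  R-dense = sparseSetsAtMost-joinChain (complement-sumPower-chain false W P)
    (sparseSetsAtMost-mono (complement W) (≤-reflexive (+-assoc r p (a′ * r))) W-dense) P-dense⁺ b′

  R-cograph : IsCograph R
  R-cograph = isCograph-chain (sumPower-chain false W P)
    (isCograph-chain (sumPower-chain true (block (r + p)) (block r)) (block-cograph (r + p)) (block-cograph r) a′)
    (isCograph-join (sum-isSum true (edgeless r) (complete (p + a′ * r))) isCograph-edgeless isCograph-complete) b′
    where
    block-cograph : ∀ c → IsCograph (block c)
    block-cograph c = isCograph-union (sum-isSum false (complete c) (edgeless q)) isCograph-complete isCograph-edgeless

prefix : ∀ {m} d → Graph (m + d) → Graph m
prefix d X = record
  { adj   = λ x y → adj X (x ↑ˡ d) (y ↑ˡ d)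
  ; sym   = λ x y → Graph.sym X (x ↑ˡ d) (y ↑ˡ d)
  ; irref = λ x → irref X (x ↑ˡ d)
  }

prefix-embeds : ∀ {m} d (X : Graph (m + d)) → Embeds (_↑ˡ d) (prefix d X) X
prefix-embeds d X _ _ = refl

MaxDegInducedLE-++⊥ : ∀ {X : Graph (a + b)} {G : Graph a} {k S} → Embeds (_↑ˡ b) G X →
  MaxDegInducedLE G k S → MaxDegInducedLE X k (S ++ ⊥)
MaxDegInducedLE-++⊥ {a} {b} {X} {G} {k} {S} emb md v v∈S with sumView a v
... | inʳ y = ⊥-elim (∉⊥ (∈-++⁻ʳ S v∈S))
... | inˡ x = subst (_≤ k) (sym degree) (md x (∈-++⁻ˡ S v∈S))
  where
  open ≡-Reasoning
  T = tabulate (λ y → adj X (x ↑ˡ b) (a ↑ʳ y))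
  degree : ∣ (S ++ ⊥) ∩ nbhd X (x ↑ˡ b) ∣ ≡ ∣ S ∩ nbhd G x ∣
  degree = begin
    ∣ (S ++ ⊥) ∩ nbhd X (x ↑ˡ b) ∣       ≡⟨ cong (λ N → ∣ (S ++ ⊥) ∩ N ∣) (nbhd-↑ˡ {X = X} {G = G} emb x) ⟩
    ∣ (S ++ ⊥) ∩ (nbhd G x ++ T) ∣       ≡⟨ cong ∣_∣ (∩-++ S (nbhd G x) ⊥ T) ⟩
    ∣ (S ∩ nbhd G x) ++ (⊥ ∩ T) ∣        ≡⟨ ∣p++q∣ (S ∩ nbhd G x) (⊥ ∩ T) ⟩
    ∣ S ∩ nbhd G x ∣ + ∣ ⊥ ∩ T ∣         ≡⟨ cong (λ Z → ∣ S ∩ nbhd G x ∣ + ∣ Z ∣) (∩-zeroˡ T) ⟩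
    ∣ S ∩ nbhd G x ∣ + ∣ ⊥ {n = b} ∣     ≡⟨ cong (∣ S ∩ nbhd G x ∣ +_) (∣⊥∣≡0 b) ⟩
    ∣ S ∩ nbhd G x ∣ + 0                 ≡⟨ +-identityʳ _ ⟩
    ∣ S ∩ nbhd G x ∣                     ∎

coRamseyProp-+ : ∀ {k i j m} d → CoRamseyProp k i j m → CoRamseyProp k i j (m + d)
coRamseyProp-+ {k} {i} {j} {m} d prop X X-cograph
  with prop (prefix d X) (isCograph-embeds {G = prefix d X} {X = X} (prefix-embeds d X) (↑ˡ-injective d _ _) X-cograph)
... | inj₁ (S , ∣S∣≡i , md) = inj₁ (S ++ ⊥ , trans (∣p++⊥∣ S) ∣S∣≡i ,
        MaxDegInducedLE-++⊥ {X = complement X} {G = complement (prefix d X)}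
          (complement-embeds (↑ˡ-injective d _ _) (prefix-embeds d X)) md)
... | inj₂ (S , ∣S∣≡j , md) = inj₂ (S ++ ⊥ , trans (∣p++⊥∣ S) ∣S∣≡j ,
        MaxDegInducedLE-++⊥ {X = X} {G = prefix d X} (prefix-embeds d X) md)

coRamseyProp-mono : ∀ {k i j m n} → m ≤ n → CoRamseyProp k i j m → CoRamseyProp k i j n
coRamseyProp-mono {k} {i} {j} {m} m≤n prop = subst (CoRamseyProp k i j) (m+[n∸m]≡n m≤n) (coRamseyProp-+ _ prop)

¬coRamseyProp : ∀ {k x y} (G : Graph n) → IsCograph G →
  SparseSetsAtMost (complement G) k x → SparseSetsAtMost G k y → ¬ CoRamseyProp k (suc x) (suc y) n
¬coRamseyProp G G-cograph dense sparse prop with prop G G-cograph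
... | inj₁ (S , ∣S∣≡ , md) = 1+n≰n (subst (_≤ _) ∣S∣≡ (dense S md))
... | inj₂ (S , ∣S∣≡ , md) = 1+n≰n (subst (_≤ _) ∣S∣≡ (sparse S md))

1+[m/n∸1]≡m/n : ∀ k {x} → suc k ≤ x → suc (pred (x / suc k)) ≡ x / suc k
1+[m/n∸1]≡m/n k {x} k<x = suc-pred (x / suc k) {{>-nonZero (m≥n⇒m/n>0 k<x)}}

module ExtremalCograph (k x y : ℕ) (k<x : suc k ≤ x) (k<y : suc k ≤ y) where

  private
    r = suc k
    p = x % r
    q = y % r
    a′ = pred (x / r)
    b′ = pred (y / r)
    open ≡-Reasoning

  open Construction k p q a′ b′

  x≡ : x ≡ r + (p + a′ * r)
  x≡ = begin
    x                   ≡⟨ m≡m%n+[m/n]*n x r ⟩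
    p + x / r * r       ≡⟨ cong (λ t → p + t * r) (1+[m/n∸1]≡m/n k k<x) ⟨
    p + suc a′ * r      ≡⟨ solve 3 (λ r p a → p :+ (con 1 :+ a) :* r := r :+ (p :+ a :* r)) refl r p a′ ⟩
    r + (p + a′ * r)    ∎

  y≡ : y ≡ r + q + b′ * r
  y≡ = begin
    y                   ≡⟨ m≡m%n+[m/n]*n y r ⟩
    q + y / r * r       ≡⟨ cong (λ t → q + t * r) (1+[m/n∸1]≡m/n k k<y) ⟨
    q + suc b′ * r      ≡⟨ solve 3 (λ r q b → q :+ (con 1 :+ b) :* r := r :+ q :+ b :* r) refl r q b′ ⟩
    r + q + b′ * r      ∎

  order≡ : powerOrder (powerOrder (r + p + q) (r + q) a′) (r + (p + a′ * r)) b′ ≡ extremalOrder k x y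
  order≡ = begin
    powerOrder (powerOrder (r + p + q) (r + q) a′) (r + (p + a′ * r)) b′
      ≡⟨ powerOrder-closed _ (r + (p + a′ * r)) b′ ⟩
    powerOrder (r + p + q) (r + q) a′ + b′ * (r + (p + a′ * r))
      ≡⟨ cong (_+ b′ * (r + (p + a′ * r))) (powerOrder-closed (r + p + q) (r + q) a′) ⟩
    r + p + q + a′ * (r + q) + b′ * (r + (p + a′ * r))
      ≡⟨ solve 5 (λ r p q a b → r :+ p :+ q :+ a :* (r :+ q) :+ b :* (r :+ (p :+ a :* r))
                   := (r :+ (p :+ a :* r)) :* (con 1 :+ b) :+ (con 1 :+ a) :* q) refl r p q a′ b′ ⟩
    (r + (p + a′ * r)) * suc b′ + suc a′ * q
      ≡⟨ cong₂ (λ s t → s * t + suc a′ * q) (sym x≡) (1+[m/n∸1]≡m/n k k<y) ⟩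
    x * (y / r) + suc a′ * q
      ≡⟨ cong (λ t → x * (y / r) + t * q) (1+[m/n∸1]≡m/n k k<x) ⟩
    extremalOrder k x y ∎

  ¬coRamseyProp-extremalOrder : ¬ CoRamseyProp k (suc x) (suc y) (extremalOrder k x y)
  ¬coRamseyProp-extremalOrder prop =
    ¬coRamseyProp R R-cograph (subst (SparseSetsAtMost (complement R) k) (sym x≡) R-dense)
      (subst (SparseSetsAtMost R k) (sym y≡) R-sparse) (subst (CoRamseyProp k (suc x) (suc y)) (sym order≡) prop)

isCoRamseyNumber-extremalOrder : ∀ k x y → suc k ≤ x → suc k ≤ y →
  IsCoRamseyNumber k (suc x) (suc y) (suc (extremalOrder k x y))
isCoRamseyNumber-extremalOrder k x y k<x k<y =
  coRamseyProp-extremalOrder k x y k<x k<y ,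
  λ m m≤F prop → ExtremalCograph.¬coRamseyProp-extremalOrder k x y k<x k<y (coRamseyProp-mono (≤-pred m≤F) prop)

theorem7p2 : (k i j : ℕ) → k + 2 ≤ i → k + 2 ≤ j →
    IsCoRamseyNumber k i j
      (1 + ((i ∸ 1) * (j ∸ 1) ∸ ((i ∸ 1) % suc k) * ((j ∸ 1) % suc k)) / suc k)
theorem7p2 k i j k+2≤i k+2≤j =
  subst₂ (λ i′ j′ → IsCoRamseyNumber k i′ j′ (1 + (x * y ∸ (x % suc k) * (y % suc k)) / suc k))
    (1+[m∸1]≡m k+2≤i) (1+[m∸1]≡m k+2≤j)
    (subst (IsCoRamseyNumber k (suc x) (suc y)) (cong suc (sym (extremalOrder-formula k x y)))
      (isCoRamseyNumber-extremalOrder k x y (k<m∸1 k+2≤i) (k<m∸1 k+2≤j)))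
  where
  x = i ∸ 1
  y = j ∸ 1
  k<m∸1 : ∀ {m} → k + 2 ≤ m → suc k ≤ m ∸ 1
  k<m∸1 {m} k+2≤m = ∸-monoˡ-≤ 1 (subst (_≤ m) (+-comm k 2) k+2≤m)
  1+[m∸1]≡m : ∀ {m} → k + 2 ≤ m → suc (m ∸ 1) ≡ m
  1+[m∸1]≡m k+2≤m = m+[n∸m]≡n (≤-trans (n≤1+n 1) (≤-trans (m≤n+m 2 k) k+2≤m))
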